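{- There is no Cayley graph $\mathrm{Cay}(G,S)$ (with $G$ a finite group, $S\subseteq G\setminus\{e\}$, $S=S^{ -1}$) which is a Neumaier graph with parameters $(35,10,3;1,5)$.
   Context: All graphs are finite, undirected and simple. The Cayley graph $\mathrm{Cay}(G,S)$ has vertex set $G$, with $x\sim y$ iff $xy^{ -1}\in S$. A $k$-regular graph on $n$ vertices is edge-regular with parameters $(n,k,\lambda)$ if every two adjacent vertices have exactly $\lambda$ common neighbours. A clique $C$ is regular with nexus $a$ if every vertex outside $C$ is adjacent to exactly $a$ vertices of $C$. A Neumaier graph with parameters $(n,k,\lambda;a,c)$ is a non-complete edge-regular graph with parameters $(n,k,\lambda)$ having a regular clique of size $c$ with nexus $a$. -}

module Defs where

open import Data.Nat using (ℕ)
open import Data.Bool using (Bool; true; false; _∧_)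
open import Data.Fin using (Fin)
open import Data.Fin.Subset using (Subset; _∈_; _∉_; ∣_∣)
open import Data.Fin.Subset.Properties using (_∈?_)
open import Data.Vec using (tabulate)
open import Data.Product using (Σ; ∃; ∃-syntax; _×_)
open import Relation.Nullary using (¬_; does)
open import Relation.Binary.PropositionalEquality using (_≡_; _≢_)
open import Algebra.Core using (Op₁; Op₂)

Graph : ℕ → Set
Graph n = Fin n → Fin n → Bool

#_ : {n : ℕ} → (Fin n → Bool) → ℕ
# f = ∣ tabulate f ∣

module _ {n : ℕ} (A : Graph n) where

  IsRegular : ℕ → Set
  IsRegular k = ∀ x → # (λ z → A x z) ≡ k

  IsEdgeRegular : ℕ → ℕ → Set
  IsEdgeRegular k λ′ =
    IsRegular k × (∀ x y → A x y ≡ true → # (λ z → A x z ∧ A z y) ≡ λ′)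

  IsNonComplete : Set
  IsNonComplete = ∃[ x ] ∃[ y ] (x ≢ y × A x y ≡ false)

  IsClique : (Fin n → Bool) → Set
  IsClique C = ∀ x y → C x ≡ true → C y ≡ true → x ≢ y → A x y ≡ true

  IsRegularClique : (Fin n → Bool) → ℕ → Set
  IsRegularClique C a =
    IsClique C × (∀ x → C x ≡ false → # (λ z → C z ∧ A x z) ≡ a)

  IsNeumaier : ℕ → ℕ → ℕ → ℕ → Set
  IsNeumaier k λ′ a c =
    IsNonComplete × IsEdgeRegular k λ′ ×
    (∃[ C ] (# C ≡ c × IsRegularClique C a))

Cay : {n : ℕ} → Op₂ (Fin n) → Op₁ (Fin n) → Subset n → Graph n
Cay _∙_ _⁻¹ S x y = does ((x ∙ (y ⁻¹)) ∈? S)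

-- Right translations are automorphisms of Cay(G,S), so translating the regular clique C gives a
-- regular clique H through e.  Two regular 5-cliques with nexus 1 that meet coincide: otherwise a common
-- vertex v has 4 + 4 neighbours in their union, and for one of its two remaining neighbours r the common
-- neighbours of v and r lie among the other one, so there are fewer than λ = 3.  Comparing H with its
-- right translates shows that H is a subgroup of order 5, say H = ⟨h⟩.  The elements x with x⁻¹hx ∉ H
-- fall into double cosets ⟨h⟩x⟨h⟩ of size 25, and 25 ∤ 35 − 5, so some t ∉ H normalises H.  Conjugation
-- by t is h ↦ hʲ with j³⁵ ≡ 1 (mod 5), so j = 1 and t commutes with h; then t⁵ ≠ e (else ⟨t⟩H would be
-- a subgroup of order 25), so g = h t⁵ has order 35: G ≅ ℤ₃₅ with H = 7ℤ₃₅.  There the connection set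
-- consists of the nonzero multiples of 7 and, by nexus 1, one element of each other class mod 7, closed
-- under negation; evaluating the 125 resulting candidates shows that λ = 3 fails.

module Submission where

open import Defs
open import Data.Bool using (Bool; true; false)
open import Data.Nat using (ℕ; suc; _+_; _≤_; _<_)
open import Data.Fin using (Fin)
open import Data.Fin.Subset using (Subset; _∈_; _∉_)
open import Algebra.Core using (Op₁; Op₂)
open import Algebra.Structures using (IsGroup)
open import Relation.Binary.PropositionalEquality using (_≡_)
open import Relation.Nullary using (¬_)
open import Data.Product using (_,_)

module Counting where

  open import Data.Bool using (Bool; true; false; _∧_; not)
  open import Data.Bool.Properties using (∧-conicalˡ; ∧-conicalʳ; ∧-identityʳ; ¬-not)
    renaming (_≟_ to _≟ᵇ_)
  open import Data.Empty using (⊥; ⊥-elim)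
  open import Data.Nat using (ℕ; zero; suc; _+_; _≤_; z≤n; s≤s)
  open import Data.Nat.Properties
    using (≤-refl; ≤-trans; ≤-antisym; n≤1+n; <⇒≢; suc-injective; +-suc; ≤-pred; +-monoˡ-≤;
           1+n≢0; n≤0⇒n≡0; +-cancelˡ-≡; +-identityʳ)
    renaming (_≟_ to _≟ℕ_)
  open import Data.Nat.Divisibility using (_∣_; _∣0; ∣-refl; ∣m∣n⇒∣m+n)
  open import Data.Fin using (Fin; zero; suc; _≟_)
  open import Data.Fin.Properties using (any?)
    renaming (suc-injective to fsuc-injective; 0≢1+n to fzero≢fsuc)
  open import Data.Product using (∃-syntax; _,_)
  open import Function using (_∘_)
  open import Relation.Nullary using (Dec; does; yes; no; contradiction)
  open import Relation.Nullary.Decidable using (dec-true; dec-false)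
  open import Relation.Binary.PropositionalEquality

  private variable m n : ℕ

  infixr 7 _∩_
  infixr 6 _∖_
  infix 4 _⊆_
  infix 5 _==_

  true≢false : ∀ {a} → a ≡ true → a ≡ false → ⊥
  true≢false refl ()

  ≡true-ext : ∀ {a b : Bool} → (a ≡ true → b ≡ true) → (b ≡ true → a ≡ true) → a ≡ b
  ≡true-ext {true}  {true}  _ _ = refl
  ≡true-ext {true}  {false} f _ = sym (f refl)
  ≡true-ext {false} {true}  _ g = g refl
  ≡true-ext {false} {false} _ _ = refl

  ∧-intro : ∀ {a b} → a ≡ true → b ≡ true → a ∧ b ≡ true
  ∧-intro refl refl = refl

  not-intro : ∀ {a} → a ≡ false → not a ≡ true
  not-intro refl = refl

  not-elim : ∀ {a} → not a ≡ true → a ≡ false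
  not-elim {false} _ = refl

  does-true⇒ : ∀ {A : Set} (a? : Dec A) → does a? ≡ true → A
  does-true⇒ (yes a) _ = a
  does-true⇒ (no _) ()

  _==_ : Fin n → Fin n → Bool
  x == y = does (x ≟ y)

  ==-refl : (x : Fin n) → x == x ≡ true
  ==-refl x = dec-true (x ≟ x) refl

  _∩_ _∖_ : (P Q : Fin n → Bool) → Fin n → Bool
  (P ∩ Q) x = P x ∧ Q x
  (P ∖ Q) x = P x ∧ not (Q x)

  _⊆_ : (P Q : Fin n → Bool) → Set
  P ⊆ Q = ∀ x → P x ≡ true → Q x ≡ true

  ∩-intro : (P Q : Fin n → Bool) {x : Fin n} → P x ≡ true → Q x ≡ true → (P ∩ Q) x ≡ true
  ∩-intro P Q = ∧-intro

  ∩-elimˡ : (P Q : Fin n → Bool) {x : Fin n} → (P ∩ Q) x ≡ true → P x ≡ true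
  ∩-elimˡ P Q {x} = ∧-conicalˡ (P x) (Q x)

  ∩-elimʳ : (P Q : Fin n → Bool) {x : Fin n} → (P ∩ Q) x ≡ true → Q x ≡ true
  ∩-elimʳ P Q {x} = ∧-conicalʳ (P x) (Q x)

  ∖-intro : (P Q : Fin n → Bool) {x : Fin n} → P x ≡ true → Q x ≡ false → (P ∖ Q) x ≡ true
  ∖-intro P Q Px Qx = ∧-intro Px (not-intro Qx)

  ∖-elimˡ : (P Q : Fin n → Bool) {x : Fin n} → (P ∖ Q) x ≡ true → P x ≡ true
  ∖-elimˡ P Q {x} = ∧-conicalˡ (P x) (not (Q x))

  ∖-elimʳ : (P Q : Fin n → Bool) {x : Fin n} → (P ∖ Q) x ≡ true → Q x ≡ false
  ∖-elimʳ P Q {x} h = not-elim (∧-conicalʳ (P x) (not (Q x)) h)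

  _without_ : (Fin n → Bool) → Fin n → Fin n → Bool
  (P without y) x = P x ∧ not (x == y)

  without-intro : (P : Fin n → Bool) {x y : Fin n} → P x ≡ true → x ≢ y → (P without y) x ≡ true
  without-intro P {x} {y} Px x≢y = ∧-intro Px (not-intro (dec-false (x ≟ y) x≢y))

  without-elimˡ : (P : Fin n → Bool) {x y : Fin n} → (P without y) x ≡ true → P x ≡ true
  without-elimˡ P {x} {y} = ∧-conicalˡ (P x) (not (x == y))

  without-elimʳ : (P : Fin n → Bool) {x y : Fin n} → (P without y) x ≡ true → x ≢ y
  without-elimʳ P {x} h refl = true≢false (==-refl x) (not-elim (∧-conicalʳ (P x) (not (x == x)) h))

  Image : (Fin m → Fin n) → Fin n → Bool
  Image g y = does (any? λ i → g i ≟ y)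

  Image-intro : (g : Fin m → Fin n) (i : Fin m) → Image g (g i) ≡ true
  Image-intro g i = dec-true (any? λ j → g j ≟ g i) (i , refl)

  Image-elim : (g : Fin m → Fin n) {y : Fin n} → Image g y ≡ true → ∃[ i ] g i ≡ y
  Image-elim g {y} = does-true⇒ (any? λ i → g i ≟ y)

  #-cong : {P Q : Fin n → Bool} → (∀ x → P x ≡ Q x) → # P ≡ # Q
  #-cong {zero}  _ = refl
  #-cong {suc n} {P} {Q} P≗Q with P zero | Q zero | P≗Q zero | #-cong {P = P ∘ suc} (P≗Q ∘ suc)
  ... | true  | .true  | refl | ih = cong suc ih
  ... | false | .false | refl | ih = ih

  #≤n : (P : Fin n → Bool) → # P ≤ n
  #≤n {zero}  P = z≤n
  #≤n {suc n} P with P zero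
  ... | true  = s≤s (#≤n (P ∘ suc))
  ... | false = ≤-trans (#≤n (P ∘ suc)) (n≤1+n n)

  #-all : # (λ (_ : Fin n) → true) ≡ n
  #-all {zero}  = refl
  #-all {suc n} = cong suc #-all

  #-split : (P Q : Fin n → Bool) → # P ≡ # (P ∩ Q) + # (P ∖ Q)
  #-split {zero}  P Q = refl
  #-split {suc n} P Q with P zero | Q zero | #-split (P ∘ suc) (Q ∘ suc)
  ... | true  | true  | ih = cong suc ih
  ... | true  | false | ih = trans (cong suc ih) (sym (+-suc _ _))
  ... | false | _     | ih = ih

  #≡0⇒false : (P : Fin n → Bool) → # P ≡ 0 → ∀ x → P x ≡ false
  #≡0⇒false {suc n} P #P≡0 x with P zero in P0
  #≡0⇒false {suc n} P ()   x       | true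
  #≡0⇒false {suc n} P #P≡0 zero    | false = P0
  #≡0⇒false {suc n} P #P≡0 (suc x) | false = #≡0⇒false (P ∘ suc) #P≡0 x

  false⇒#≡0 : (P : Fin n → Bool) → (∀ x → P x ≡ false) → # P ≡ 0
  false⇒#≡0 {zero}  P _ = refl
  false⇒#≡0 {suc n} P none with P zero | none zero
  ... | false | refl = false⇒#≡0 (P ∘ suc) (none ∘ suc)

  -- Abstract (as is `order` below) so that the witnesses it produces are never unfolded during type checking.
  abstract
    #≢0⇒∃ : (P : Fin n → Bool) → # P ≢ 0 → ∃[ x ] P x ≡ true
    #≢0⇒∃ P #P≢0 with any? (λ x → P x ≟ᵇ true)
    ... | yes found = found
    ... | no  none  = contradiction (false⇒#≡0 P λ x → ¬-not λ Px → none (x , Px)) #P≢0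

  #≡1+n⇒∃ : (P : Fin n → Bool) → # P ≡ suc m → ∃[ x ] P x ≡ true
  #≡1+n⇒∃ P #P≡1+m = #≢0⇒∃ P λ #P≡0 → 1+n≢0 (trans (sym #P≡1+m) #P≡0)

  #≡n⇒true : (P : Fin n → Bool) → # P ≡ n → ∀ x → P x ≡ true
  #≡n⇒true {suc n} P #P≡n x with P zero in P0
  #≡n⇒true {suc n} P #P≡n zero    | true  = P0
  #≡n⇒true {suc n} P #P≡n (suc x) | true  = #≡n⇒true (P ∘ suc) (suc-injective #P≡n) x
  #≡n⇒true {suc n} P #P≡n x       | false = contradiction #P≡n (<⇒≢ (s≤s (#≤n (P ∘ suc))))

  #-remove : (P : Fin n → Bool) {y : Fin n} → P y ≡ true → # P ≡ suc (# (P without y))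
  #-remove {suc n} P {zero} Py rewrite Py =
    cong suc (#-cong λ x → sym (∧-identityʳ (P (suc x))))
  #-remove {suc n} P {suc y} Py with P zero | #-remove (P ∘ suc) Py
  ... | true  | ih = cong suc ih
  ... | false | ih = ih

  #-without : (P : Fin n → Bool) {y : Fin n} → P y ≡ true → # P ≡ suc m → # (P without y) ≡ m
  #-without P Py #P≡1+m = suc-injective (trans (sym (#-remove P Py)) #P≡1+m)

  #-injection : (P : Fin m → Bool) (Q : Fin n → Bool) (φ : Fin m → Fin n) →
    (∀ x y → P x ≡ true → P y ≡ true → φ x ≡ φ y → x ≡ y) →
    (∀ x → P x ≡ true → Q (φ x) ≡ true) → # P ≤ # Q
  #-injection {zero}  P Q φ inj maps = z≤n
  #-injection {suc m} P Q φ inj maps with P zero in P0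
  ... | false = #-injection (P ∘ suc) Q (φ ∘ suc) (λ x y Px Py eq → fsuc-injective (inj _ _ Px Py eq)) (maps ∘ suc)
  ... | true = subst (suc (# (P ∘ suc)) ≤_) (sym (#-remove Q (maps zero P0)))
    (s≤s (#-injection (P ∘ suc) (Q without φ zero) (φ ∘ suc) (λ x y Px Py eq → fsuc-injective (inj _ _ Px Py eq)) maps′))
    where
    maps′ : ∀ x → P (suc x) ≡ true → (Q without φ zero) (φ (suc x)) ≡ true
    maps′ x Px = without-intro Q (maps (suc x) Px) λ eq → fzero≢fsuc (inj _ _ P0 Px (sym eq))

  #-mono : {P Q : Fin n → Bool} → P ⊆ Q → # P ≤ # Q
  #-mono {P = P} {Q} P⊆Q = #-injection P Q (λ x → x) (λ _ _ _ _ eq → eq) P⊆Q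

  ⊆∧#≡⇒⊇ : {P Q : Fin n → Bool} → P ⊆ Q → # P ≡ # Q → Q ⊆ P
  ⊆∧#≡⇒⊇ {P = P} {Q} P⊆Q #P≡#Q x Qx with P x in Px
  ... | true  = refl
  ... | false = ⊥-elim (true≢false (∖-intro Q P Qx Px) (#≡0⇒false (Q ∖ P) #Q∖P≡0 x))
    where
    Q∩P≗P : ∀ y → (Q ∩ P) y ≡ P y
    Q∩P≗P y = ≡true-ext (∩-elimʳ Q P) (λ Py → ∩-intro Q P (P⊆Q y Py) Py)
    #Q∖P≡0 : # (Q ∖ P) ≡ 0
    #Q∖P≡0 = +-cancelˡ-≡ (# P) _ _ (begin
      # P + # (Q ∖ P)       ≡⟨ cong (_+ # (Q ∖ P)) (sym (#-cong Q∩P≗P)) ⟩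
      # (Q ∩ P) + # (Q ∖ P) ≡⟨ sym (#-split Q P) ⟩
      # Q                   ≡⟨ sym #P≡#Q ⟩
      # P                   ≡⟨ sym (+-identityʳ (# P)) ⟩
      # P + 0               ∎)
      where open ≡-Reasoning

  #-∘-inverse : (P : Fin n → Bool) (φ ψ : Fin n → Fin n) →
    (∀ x → ψ (φ x) ≡ x) → (∀ y → φ (ψ y) ≡ y) → # (P ∘ φ) ≡ # P
  #-∘-inverse P φ ψ ψφ φψ = ≤-antisym
    (#-injection (P ∘ φ) P φ (λ x y _ _ eq → trans (sym (ψφ x)) (trans (cong ψ eq) (ψφ y)))
      (λ _ Pφx → Pφx))
    (#-injection P (P ∘ φ) ψ (λ x y _ _ eq → trans (sym (φψ x)) (trans (cong φ eq) (φψ y)))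
      (λ x Px → subst (λ z → P z ≡ true) (sym (φψ x)) Px))

  2≤# : (P : Fin n → Bool) {x y : Fin n} → P x ≡ true → P y ≡ true → x ≢ y → 2 ≤ # P
  2≤# P {x} {y} Px Py x≢y
    rewrite #-remove P Px | #-remove (P without x) (without-intro P Py (x≢y ∘ sym)) =
    s≤s (s≤s z≤n)

  #-image : (g : Fin m → Fin n) → (∀ i j → g i ≡ g j → i ≡ j) → # (Image g) ≡ m
  #-image {zero}  g inj = false⇒#≡0 (Image g) λ y → dec-false (any? λ i → g i ≟ y) λ ()
  #-image {suc m} g inj = begin
    # (Image g)                 ≡⟨ #-remove (Image g) (Image-intro g zero) ⟩
    suc (# (Image g without g zero)) ≡⟨ cong suc (#-cong image-rest) ⟩
    suc (# (Image (g ∘ suc)))   ≡⟨ cong suc (#-image (g ∘ suc) λ i j eq → fsuc-injective (inj _ _ eq)) ⟩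
    suc m                       ∎
    where
    open ≡-Reasoning
    image-rest : ∀ y → (Image g without g zero) y ≡ Image (g ∘ suc) y
    image-rest y = ≡true-ext to from
      where
      to : (Image g without g zero) y ≡ true → Image (g ∘ suc) y ≡ true
      to h with Image-elim g (without-elimˡ (Image g) h)
      ... | zero  , refl = contradiction refl (without-elimʳ (Image g) h)
      ... | suc i , refl = Image-intro (g ∘ suc) i
      from : Image (g ∘ suc) y ≡ true → (Image g without g zero) y ≡ true
      from h with Image-elim (g ∘ suc) h
      ... | i , refl = without-intro (Image g) (Image-intro g (suc i)) λ eq → fzero≢fsuc (sym (inj _ _ eq))

  module _ (R : Fin n → Fin n → Bool)
    (R-refl : ∀ x → R x x ≡ true)
    (R-sym : ∀ x y → R x y ≡ true → R y x ≡ true)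
    (R-trans : ∀ x y z → R x y ≡ true → R y z ≡ true → R x z ≡ true)
    where

    classes-∣ : (m : ℕ) (P : Fin n → Bool) → (∀ x → P x ≡ true → # (P ∩ R x) ≡ m) → m ∣ # P
    classes-∣ m P = go (# P) P ≤-refl
      where
      -- Removing the class of some x ∈ P leaves the classes of the remaining elements unchanged.
      go : ∀ fuel P → # P ≤ fuel → (∀ x → P x ≡ true → # (P ∩ R x) ≡ m) → m ∣ # P
      go fuel P #P≤fuel classSize with # P ≟ℕ 0
      ... | yes #P≡0 rewrite #P≡0 = m ∣0
      go zero P #P≤0 classSize | no #P≢0 = contradiction (n≤0⇒n≡0 #P≤0) #P≢0
      go (suc fuel) P #P≤fuel classSize | no #P≢0 with #≢0⇒∃ P #P≢0
      ... | x , Px = subst (m ∣_) (sym #P≡m+#P′) (∣m∣n⇒∣m+n ∣-refl (go fuel P′ #P′≤fuel classSize′))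
        where
        P′ : Fin n → Bool
        P′ = P ∖ R x
        #P≡m+#P′ : # P ≡ m + # P′
        #P≡m+#P′ = trans (#-split P (R x)) (cong (_+ # P′) (classSize x Px))
        1≤m : 1 ≤ m
        1≤m = subst (1 ≤_) (classSize x Px)
          (subst (1 ≤_) (sym (#-remove (P ∩ R x) (∩-intro P (R x) Px (R-refl x)))) (s≤s z≤n))
        #P′≤fuel : # P′ ≤ fuel
        #P′≤fuel = ≤-pred (≤-trans (+-monoˡ-≤ (# P′) 1≤m) (subst (_≤ suc fuel) #P≡m+#P′ #P≤fuel))
        same-class : ∀ x′ → P′ x′ ≡ true → ∀ y → (P′ ∩ R x′) y ≡ (P ∩ R x′) y
        same-class x′ P′x′ y = ≡true-ext
          (λ h → ∩-intro P (R x′) (∖-elimˡ P (R x) (∩-elimˡ P′ (R x′) h)) (∩-elimʳ P′ (R x′) h))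
          (λ h → ∩-intro P′ (R x′) (∖-intro P (R x) (∩-elimˡ P (R x′) h) (¬xRy h)) (∩-elimʳ P (R x′) h))
          where
          ¬xRy : (P ∩ R x′) y ≡ true → R x y ≡ false
          ¬xRy h with R x y in xRy
          ... | false = refl
          ... | true = ⊥-elim (true≢false (R-trans x y x′ xRy (R-sym x′ y (∩-elimʳ P (R x′) h)))
                                          (∖-elimʳ P (R x) P′x′))
        classSize′ : ∀ x′ → P′ x′ ≡ true → # (P′ ∩ R x′) ≡ m
        classSize′ x′ P′x′ = trans (#-cong (same-class x′ P′x′)) (classSize x′ (∖-elimˡ P (R x) P′x′))

module Arithmetic where

  open import Data.Nat using (ℕ; zero; suc; _*_; _^_; _%_; _≤_; _<_; z≤n; s≤s)
  open import Data.Nat.Properties using (≤-pred; ≤-trans; anyUpTo?)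
  open import Data.Nat.Divisibility using (_∣_; 0∣⇒≡0; n∣m⇒m%n≡0; *-monoʳ-∣)
  open import Data.Nat.Coprimality using (coprime?; coprime-divisor; coprime-factors)
  open import Data.Nat.Primality using (prime?; prime⇒irreducible)
  open import Data.Sum using (inj₁; inj₂)
  open import Data.Product using (∃-syntax; _×_; _,_)
  open import Level using (0ℓ)
  open import Relation.Nullary using (¬_; yes; no; contradiction)
  open import Relation.Nullary.Decidable using (from-yes)
  open import Relation.Unary using (Pred; Decidable)
  open import Relation.Binary.PropositionalEquality using (_≡_; _≢_; refl)

  module _ {P : Pred ℕ 0ℓ} (P? : Decidable P) where

    least-witness : ∀ m → (∃[ j ] (j ≤ m × P j)) → ∃[ k ] (P k × ∀ j → j < k → ¬ P j)
    least-witness zero    (.zero , z≤n , P0) = zero , P0 , λ _ ()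
    least-witness (suc m) (j , j≤m , Pj) with anyUpTo? P? (suc m)
    ... | yes (i , i<m , Pi) = least-witness m (i , ≤-pred i<m , Pi)
    ... | no none = j , Pj , λ i i<j Pi → none (i , ≤-trans i<j j≤m , Pi)

  ∣35∧≤5⇒≡5 : ∀ {d} → d ∣ 35 → d ≤ 5 → d ≢ 1 → d ≡ 5
  ∣35∧≤5⇒≡5 {0} 0∣35 _ _ = contradiction (0∣⇒≡0 0∣35) λ ()
  ∣35∧≤5⇒≡5 {1} _ _ d≢1 = contradiction refl d≢1
  ∣35∧≤5⇒≡5 {2} 2∣35 _ _ = contradiction (n∣m⇒m%n≡0 35 2 2∣35) λ ()
  ∣35∧≤5⇒≡5 {3} 3∣35 _ _ = contradiction (n∣m⇒m%n≡0 35 3 3∣35) λ ()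
  ∣35∧≤5⇒≡5 {4} 4∣35 _ _ = contradiction (n∣m⇒m%n≡0 35 4 4∣35) λ ()
  ∣35∧≤5⇒≡5 {5} _ _ _ = refl
  ∣35∧≤5⇒≡5 {suc (suc (suc (suc (suc (suc _)))))} _ (s≤s (s≤s (s≤s (s≤s (s≤s ()))))) _

  ∣7⇒≡7 : ∀ {d} → d ∣ 7 → d ≢ 1 → d ≡ 7
  ∣7⇒≡7 d∣7 d≢1 with prime⇒irreducible (from-yes (prime? 7)) d∣7
  ... | inj₁ d≡1 = contradiction d≡1 d≢1
  ... | inj₂ d≡7 = d≡7

  7∣5*m⇒7∣m : ∀ {m} → 7 ∣ 5 * m → 7 ∣ m
  7∣5*m⇒7∣m = coprime-divisor (from-yes (coprime? 7 5))

  5∣7*m⇒5∣m : ∀ {m} → 5 ∣ 7 * m → 5 ∣ m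
  5∣7*m⇒5∣m = coprime-divisor (from-yes (coprime? 5 7))

  5∣m∧7∣m⇒35∣m : ∀ {m} → 5 ∣ m → 7 ∣ m → 35 ∣ m
  5∣m∧7∣m⇒35∣m {m} 5∣m 7∣m = coprime-factors (from-yes (coprime? 5 7)) (*-monoʳ-∣ 5 7∣m , *-monoʳ-∣ 7 5∣m)

  fermat-5 : ∀ {d} → 0 < d → d < 5 → (d * (d * (d * d))) % 5 ≡ 1
  fermat-5 {1} _ _ = refl
  fermat-5 {2} _ _ = refl
  fermat-5 {3} _ _ = refl
  fermat-5 {4} _ _ = refl
  fermat-5 {suc (suc (suc (suc (suc _))))} _ (s≤s (s≤s (s≤s (s≤s (s≤s ())))))

  ^35≡1-mod-5 : ∀ {j} → j < 5 → (j ^ 35) % 5 ≡ 1 → j ≡ 1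
  ^35≡1-mod-5 {1} _ _ = refl
  ^35≡1-mod-5 {0} _ ()
  ^35≡1-mod-5 {2} _ ()
  ^35≡1-mod-5 {3} _ ()
  ^35≡1-mod-5 {4} _ ()
  ^35≡1-mod-5 {suc (suc (suc (suc (suc _))))} (s≤s (s≤s (s≤s (s≤s (s≤s ()))))) _

module FiniteGroup {n : ℕ} {_·_ : Op₂ (Fin n)} {ε : Fin n} {_⁻¹′ : Op₁ (Fin n)}
  (isGroup : IsGroup _≡_ _·_ ε _⁻¹′) where

  open Counting
  open Arithmetic using (least-witness; fermat-5)
  open import Algebra.Bundles using (Group)
  import Algebra.Properties.Group as GroupProperties
  import Algebra.Properties.Monoid.Mult as MonoidMult
  open import Data.Bool using (Bool; true)
  open import Data.Nat using (zero; suc; pred; _+_; _*_; _∸_; _≤_; _<_; s≤s; _%_; _/_; NonZero; >-nonZero)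
  open import Data.Nat.Properties
    using (*-comm; m∸n+n≡m; m+[n∸m]≡n; <⇒≤; <-cmp; m<n⇒0<n∸m; m∸n≤m; ≤-trans; ≤-refl;
           n<1+n; ≤-pred; <⇒≱; suc-pred; ≤-<-trans)
  open import Data.Nat.DivMod using (m≡m%n+[m/n]*n; m%n<n)
  open import Data.Nat.Divisibility using (_∣_; divides; m%n≡0⇒n∣m; ∣⇒≤)
  open import Data.Fin using (zero; suc; toℕ; fromℕ<; _≟_; combine; remQuot)
  open import Data.Fin.Properties using (toℕ-fromℕ<; toℕ<n; toℕ-injective; pigeonhole; remQuot-combine; combine-remQuot)
  open import Data.Product using (∃-syntax; _×_; _,_; proj₁; proj₂; uncurry)
  open import Function using (_∘_)
  open import Relation.Binary.Definitions using (tri<; tri≈; tri>)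
  open import Relation.Nullary using (contradiction)
  open import Relation.Binary.PropositionalEquality
  open ≡-Reasoning

  group : Group _ _
  group = record { isGroup = isGroup }

  open Group group public using (_∙_; _⁻¹; assoc; identityˡ; identityʳ; inverseˡ; inverseʳ)
    renaming (ε to e)
  open GroupProperties group public
    using (∙-cancelˡ; ∙-cancelʳ; ⁻¹-involutive; ⁻¹-anti-homo-∙; ⁻¹-anti-homo-//; ⁻¹-anti-homo-\\;
           ε⁻¹≈ε; inverseʳ-unique;
           \\-leftDividesˡ; \\-leftDividesʳ; //-rightDividesˡ; //-rightDividesʳ)
  open MonoidMult (Group.monoid group) using (×-homo-+; ×-assocˡ; ×-homo-1) renaming (_×_ to _times_)

  infixr 25 _^_

  _^_ : Fin n → ℕ → Fin n
  x ^ k = k times x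

  ^-+ : ∀ x a b → x ^ (a + b) ≡ x ^ a ∙ x ^ b
  ^-+ x a b = ×-homo-+ x a b

  ^-* : ∀ x a b → (x ^ a) ^ b ≡ x ^ (a * b)
  ^-* x a b = trans (×-assocˡ x b a) (cong (x ^_) (*-comm b a))

  ^-1 : ∀ x → x ^ 1 ≡ x
  ^-1 = ×-homo-1

  e^ : ∀ k → e ^ k ≡ e
  e^ zero    = refl
  e^ (suc k) = trans (identityˡ _) (e^ k)

  ^-cancel : ∀ x {a b} → a < b → x ^ a ≡ x ^ b → x ^ (b ∸ a) ≡ e
  ^-cancel x {a} {b} a<b eq = ∙-cancelʳ (x ^ a) _ _ (begin
    x ^ (b ∸ a) ∙ x ^ a ≡⟨ ^-+ x (b ∸ a) a ⟨
    x ^ (b ∸ a + a)     ≡⟨ cong (x ^_) (m∸n+n≡m (<⇒≤ a<b)) ⟩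
    x ^ b               ≡⟨ eq ⟨
    x ^ a               ≡⟨ identityˡ _ ⟨
    e ∙ x ^ a           ∎)

  ^-∣ : ∀ x {a b} → x ^ a ≡ e → a ∣ b → x ^ b ≡ e
  ^-∣ x {a} x^a≡e (divides q refl) = begin
    x ^ (q * a)   ≡⟨ cong (x ^_) (*-comm q a) ⟩
    x ^ (a * q)   ≡⟨ ^-* x a q ⟨
    (x ^ a) ^ q   ≡⟨ cong (_^ q) x^a≡e ⟩
    e ^ q         ≡⟨ e^ q ⟩
    e             ∎

  ^-mod : ∀ x d .{{_ : NonZero d}} → x ^ d ≡ e → ∀ k → x ^ k ≡ x ^ (k % d)
  ^-mod x d x^d≡e k = begin
    x ^ k                         ≡⟨ cong (x ^_) (m≡m%n+[m/n]*n k d) ⟩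
    x ^ (k % d + (k / d) * d)     ≡⟨ ^-+ x (k % d) ((k / d) * d) ⟩
    x ^ (k % d) ∙ x ^ ((k / d) * d) ≡⟨ cong (x ^ (k % d) ∙_) (^-∣ x x^d≡e (divides (k / d) refl)) ⟩
    x ^ (k % d) ∙ e               ≡⟨ identityʳ _ ⟩
    x ^ (k % d)                   ∎

  ^-inverse : ∀ x {d} → x ^ d ≡ e → ∀ {k} → k ≤ d → x ^ (d ∸ k) ≡ (x ^ k) ⁻¹
  ^-inverse x {d} x^d≡e {k} k≤d = inverseʳ-unique (x ^ k) (x ^ (d ∸ k))
    (trans (sym (^-+ x k (d ∸ k))) (trans (cong (x ^_) (m+[n∸m]≡n k≤d)) x^d≡e))

  ^-comm : ∀ {x y} → x ∙ y ≡ y ∙ x → ∀ k → x ^ k ∙ y ≡ y ∙ x ^ k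
  ^-comm {x} {y} xy≡yx zero    = trans (identityˡ y) (sym (identityʳ y))
  ^-comm {x} {y} xy≡yx (suc k) = begin
    (x ∙ x ^ k) ∙ y ≡⟨ assoc x (x ^ k) y ⟩
    x ∙ (x ^ k ∙ y) ≡⟨ cong (x ∙_) (^-comm xy≡yx k) ⟩
    x ∙ (y ∙ x ^ k) ≡⟨ assoc x y (x ^ k) ⟨
    (x ∙ y) ∙ x ^ k ≡⟨ cong (_∙ x ^ k) xy≡yx ⟩
    (y ∙ x) ∙ x ^ k ≡⟨ assoc y x (x ^ k) ⟩
    y ∙ (x ∙ x ^ k) ∎

  ^-comm² : ∀ {x y} → x ∙ y ≡ y ∙ x → ∀ a b → x ^ a ∙ y ^ b ≡ y ^ b ∙ x ^ a
  ^-comm² xy≡yx a b = sym (^-comm (sym (^-comm xy≡yx a)) b)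

  ^-∙-distrib : ∀ {x y} → x ∙ y ≡ y ∙ x → ∀ k → (x ∙ y) ^ k ≡ x ^ k ∙ y ^ k
  ^-∙-distrib {x} {y} xy≡yx zero    = sym (identityˡ e)
  ^-∙-distrib {x} {y} xy≡yx (suc k) = begin
    (x ∙ y) ∙ (x ∙ y) ^ k       ≡⟨ cong ((x ∙ y) ∙_) (^-∙-distrib xy≡yx k) ⟩
    (x ∙ y) ∙ (x ^ k ∙ y ^ k)   ≡⟨ assoc x y _ ⟩
    x ∙ (y ∙ (x ^ k ∙ y ^ k))   ≡⟨ cong (x ∙_) (assoc y (x ^ k) (y ^ k)) ⟨
    x ∙ ((y ∙ x ^ k) ∙ y ^ k)   ≡⟨ cong (λ z → x ∙ (z ∙ y ^ k)) (^-comm xy≡yx k) ⟨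
    x ∙ ((x ^ k ∙ y) ∙ y ^ k)   ≡⟨ cong (x ∙_) (assoc (x ^ k) y (y ^ k)) ⟩
    x ∙ (x ^ k ∙ (y ∙ y ^ k))   ≡⟨ assoc x (x ^ k) _ ⟨
    (x ∙ x ^ k) ∙ (y ∙ y ^ k)   ∎

  conj : Fin n → Fin n → Fin n
  conj a x = (a ⁻¹ ∙ x) ∙ a

  conj-∙ : ∀ a x y → conj a (x ∙ y) ≡ conj a x ∙ conj a y
  conj-∙ a x y = sym (begin
    (a ⁻¹ ∙ x) ∙ a ∙ ((a ⁻¹ ∙ y) ∙ a) ≡⟨ assoc (a ⁻¹ ∙ x) a _ ⟩
    (a ⁻¹ ∙ x) ∙ (a ∙ ((a ⁻¹ ∙ y) ∙ a)) ≡⟨ cong ((a ⁻¹ ∙ x) ∙_) (assoc a (a ⁻¹ ∙ y) a) ⟨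
    (a ⁻¹ ∙ x) ∙ ((a ∙ (a ⁻¹ ∙ y)) ∙ a) ≡⟨ cong (λ z → (a ⁻¹ ∙ x) ∙ (z ∙ a)) (\\-leftDividesˡ a y) ⟩
    (a ⁻¹ ∙ x) ∙ (y ∙ a)               ≡⟨ assoc (a ⁻¹ ∙ x) y a ⟨
    ((a ⁻¹ ∙ x) ∙ y) ∙ a               ≡⟨ cong (_∙ a) (assoc (a ⁻¹) x y) ⟩
    (a ⁻¹ ∙ (x ∙ y)) ∙ a               ∎)

  conj-e : ∀ a → conj a e ≡ e
  conj-e a = trans (cong (_∙ a) (identityʳ (a ⁻¹))) (inverseˡ a)

  conj-^ : ∀ a x k → conj a x ^ k ≡ conj a (x ^ k)
  conj-^ a x zero    = sym (conj-e a)
  conj-^ a x (suc k) = trans (cong (conj a x ∙_) (conj-^ a x k)) (sym (conj-∙ a x (x ^ k)))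

  conj-∙ˡ : ∀ a b x → conj (a ∙ b) x ≡ conj b (conj a x)
  conj-∙ˡ a b x = begin
    ((a ∙ b) ⁻¹ ∙ x) ∙ (a ∙ b)         ≡⟨ cong (λ z → (z ∙ x) ∙ (a ∙ b)) (⁻¹-anti-homo-∙ a b) ⟩
    ((b ⁻¹ ∙ a ⁻¹) ∙ x) ∙ (a ∙ b)       ≡⟨ cong (_∙ (a ∙ b)) (assoc (b ⁻¹) (a ⁻¹) x) ⟩
    (b ⁻¹ ∙ (a ⁻¹ ∙ x)) ∙ (a ∙ b)       ≡⟨ assoc (b ⁻¹ ∙ (a ⁻¹ ∙ x)) a b ⟨
    ((b ⁻¹ ∙ (a ⁻¹ ∙ x)) ∙ a) ∙ b       ≡⟨ cong (_∙ b) (assoc (b ⁻¹) (a ⁻¹ ∙ x) a) ⟩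
    (b ⁻¹ ∙ ((a ⁻¹ ∙ x) ∙ a)) ∙ b       ∎

  conj-identity : ∀ x → conj e x ≡ x
  conj-identity x = begin
    e ⁻¹ ∙ x ∙ e   ≡⟨ identityʳ (e ⁻¹ ∙ x) ⟩
    e ⁻¹ ∙ x       ≡⟨ cong (_∙ x) ε⁻¹≈ε ⟩
    e ∙ x          ≡⟨ identityˡ x ⟩
    x              ∎

  conj-inverse : ∀ a x → conj (a ⁻¹) (conj a x) ≡ x
  conj-inverse a x = begin
    conj (a ⁻¹) (conj a x)    ≡⟨ conj-∙ˡ a (a ⁻¹) x ⟨
    conj (a ∙ a ⁻¹) x         ≡⟨ cong (λ b → conj b x) (inverseʳ a) ⟩
    conj e x                  ≡⟨ conj-identity x ⟩
    x                         ∎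

  comm⇒conj-fixed : ∀ {a x} → x ∙ a ≡ a ∙ x → conj a x ≡ x
  comm⇒conj-fixed {a} {x} xa≡ax = begin
    a ⁻¹ ∙ x ∙ a     ≡⟨ assoc (a ⁻¹) x a ⟩
    a ⁻¹ ∙ (x ∙ a)   ≡⟨ cong (a ⁻¹ ∙_) xa≡ax ⟩
    a ⁻¹ ∙ (a ∙ x)   ≡⟨ \\-leftDividesʳ a x ⟩
    x                ∎

  conj-fixed⇒comm : ∀ {a x} → conj a x ≡ x → x ∙ a ≡ a ∙ x
  conj-fixed⇒comm {a} {x} eq = begin
    x ∙ a                  ≡⟨ \\-leftDividesˡ a (x ∙ a) ⟨
    a ∙ (a ⁻¹ ∙ (x ∙ a))   ≡⟨ cong (a ∙_) (assoc (a ⁻¹) x a) ⟨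
    a ∙ conj a x           ≡⟨ cong (a ∙_) eq ⟩
    a ∙ x                  ∎

  record IsSubgroup (K : Fin n → Bool) : Set where
    field
      e∈ : K e ≡ true
      ∙-closed : ∀ {x y} → K x ≡ true → K y ≡ true → K (x ∙ y) ≡ true
      ⁻¹-closed : ∀ {x} → K x ≡ true → K (x ⁻¹) ≡ true

    ^-closed : ∀ {x} → K x ≡ true → ∀ k → K (x ^ k) ≡ true
    ^-closed Kx zero    = e∈
    ^-closed Kx (suc k) = ∙-closed Kx (^-closed Kx k)

    ⁻¹-∈ : ∀ x → K (x ⁻¹) ≡ K x
    ⁻¹-∈ x = ≡true-ext (λ K[x⁻¹] → subst (λ y → K y ≡ true) (⁻¹-involutive x) (⁻¹-closed K[x⁻¹])) ⁻¹-closed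

    conj-closed : ∀ {k z} → K k ≡ true → K z ≡ true → K (conj k z) ≡ true
    conj-closed Kk Kz = ∙-closed (∙-closed (⁻¹-closed Kk) Kz) Kk

    conj-∈ : ∀ {k} z → K k ≡ true → K (conj k z) ≡ K z
    conj-∈ {k} z Kk = ≡true-ext
      (λ K[conj] → subst (λ w → K w ≡ true) (conj-inverse k z) (conj-closed (⁻¹-closed Kk) K[conj]))
      (conj-closed Kk)

  module _ {K : Fin n → Bool} (K-subgroup : IsSubgroup K) where
    open IsSubgroup K-subgroup

    lagrange-∣ : (P : Fin n → Bool) → (∀ {x k} → P x ≡ true → K k ≡ true → P (x ∙ k) ≡ true) →
      # K ∣ # P
    lagrange-∣ P P∙K⊆P = classes-∣ sameCoset sameCoset-refl sameCoset-sym sameCoset-trans (# K) P coset-size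
      where
      sameCoset : Fin n → Fin n → Bool
      sameCoset x y = K (x ⁻¹ ∙ y)
      sameCoset-refl : ∀ x → sameCoset x x ≡ true
      sameCoset-refl x = trans (cong K (inverseˡ x)) e∈
      sameCoset-sym : ∀ x y → sameCoset x y ≡ true → sameCoset y x ≡ true
      sameCoset-sym x y xy = subst (λ z → K z ≡ true) (⁻¹-anti-homo-\\ x y) (⁻¹-closed xy)
      sameCoset-trans : ∀ x y z → sameCoset x y ≡ true → sameCoset y z ≡ true → sameCoset x z ≡ true
      sameCoset-trans x y z xy yz = subst (λ w → K w ≡ true) (begin
        (x ⁻¹ ∙ y) ∙ (y ⁻¹ ∙ z) ≡⟨ assoc (x ⁻¹) y _ ⟩
        x ⁻¹ ∙ (y ∙ (y ⁻¹ ∙ z)) ≡⟨ cong (x ⁻¹ ∙_) (\\-leftDividesˡ y z) ⟩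
        x ⁻¹ ∙ z                ∎) (∙-closed xy yz)
      coset-size : ∀ x → P x ≡ true → # (P ∩ sameCoset x) ≡ # K
      coset-size x Px = trans (#-cong P∩xK≗xK) (#-∘-inverse K (x ⁻¹ ∙_) (x ∙_) (\\-leftDividesˡ x) (\\-leftDividesʳ x))
        where
        P∩xK≗xK : ∀ y → (P ∩ sameCoset x) y ≡ K (x ⁻¹ ∙ y)
        P∩xK≗xK y = ≡true-ext (∩-elimʳ P (sameCoset x)) λ xy →
          ∩-intro P (sameCoset x) (subst (λ z → P z ≡ true) (\\-leftDividesˡ x y) (P∙K⊆P Px xy)) xy

    lagrange : # K ∣ n
    lagrange = subst (# K ∣_) #-all (lagrange-∣ (λ _ → true) λ _ _ → refl)

  record HasOrder (x : Fin n) (d : ℕ) : Set where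
    field
      ^-order : x ^ d ≡ e
      order-∣ : ∀ {m} → x ^ m ≡ e → d ∣ m

  abstract
    order : ∀ x → ∃[ k ] HasOrder x (suc k)
    order x with pigeonhole (n<1+n n) (λ (i : Fin (suc n)) → x ^ toℕ i)
    ... | i , j , i<j , x^i≡x^j
      with least-witness (λ k → x ^ suc k ≟ e) (pred (toℕ j ∸ toℕ i)) (_ , ≤-refl , x^[1+k]≡e)
      where
      x^[1+k]≡e : x ^ suc (pred (toℕ j ∸ toℕ i)) ≡ e
      x^[1+k]≡e = trans (cong (x ^_) (suc-pred (toℕ j ∸ toℕ i) {{>-nonZero (m<n⇒0<n∸m i<j)}}))
                        (^-cancel x i<j x^i≡x^j)
    ... | k , x^[1+k]≡e , minimal = k , record { ^-order = x^[1+k]≡e ; order-∣ = order-∣ }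
      where
      order-∣ : ∀ {m} → x ^ m ≡ e → suc k ∣ m
      order-∣ {m} x^m≡e with m % suc k in m%d | m%n<n m (suc k)
      ... | zero  | _ = m%n≡0⇒n∣m m (suc k) m%d
      ... | suc r | r<k = contradiction (trans (sym (trans (^-mod x (suc k) x^[1+k]≡e m) (cong (x ^_) m%d))) x^m≡e)
                            (minimal r (≤-pred r<k))

  module _ {x : Fin n} {d : ℕ} .{{_ : NonZero d}} (x-order : HasOrder x d) where
    open HasOrder x-order

    ^-injective : ∀ {a b} → a < d → b < d → x ^ a ≡ x ^ b → a ≡ b
    ^-injective {a} {b} a<d b<d x^a≡x^b with <-cmp a b
    ... | tri≈ _ a≡b _ = a≡b
    ... | tri< a<b _ _ = contradiction (∣⇒≤ {{>-nonZero (m<n⇒0<n∸m a<b)}} (order-∣ (^-cancel x a<b x^a≡x^b)))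
                                       (<⇒≱ (≤-trans (s≤s (m∸n≤m b a)) b<d))
    ... | tri> _ _ b<a = contradiction (∣⇒≤ {{>-nonZero (m<n⇒0<n∸m b<a)}} (order-∣ (^-cancel x b<a (sym x^a≡x^b))))
                                       (<⇒≱ (≤-trans (s≤s (m∸n≤m a b)) a<d))

    powers : Fin n → Bool
    powers = Image λ (i : Fin d) → x ^ toℕ i

    powers-intro : ∀ k → powers (x ^ k) ≡ true
    powers-intro k = subst (λ z → powers z ≡ true) x^k%d≡x^k (Image-intro (λ (i : Fin d) → x ^ toℕ i) (fromℕ< (m%n<n k d)))
      where
      x^k%d≡x^k : x ^ toℕ (fromℕ< (m%n<n k d)) ≡ x ^ k
      x^k%d≡x^k = trans (cong (x ^_) (toℕ-fromℕ< (m%n<n k d))) (sym (^-mod x d ^-order k))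

    powers-elim : ∀ {y} → powers y ≡ true → ∃[ k ] (k < d × x ^ k ≡ y)
    powers-elim y∈ with Image-elim (λ (i : Fin d) → x ^ toℕ i) y∈
    ... | i , x^i≡y = toℕ i , toℕ<n i , x^i≡y

    #powers : # powers ≡ d
    #powers = #-image _ λ i j x^i≡x^j → toℕ-injective (^-injective (toℕ<n i) (toℕ<n j) x^i≡x^j)

    powers-subgroup : IsSubgroup powers
    powers-subgroup = record { e∈ = powers-intro 0 ; ∙-closed = ∙-closed ; ⁻¹-closed = ⁻¹-closed }
      where
      ∙-closed : ∀ {y z} → powers y ≡ true → powers z ≡ true → powers (y ∙ z) ≡ true
      ∙-closed y∈ z∈ with powers-elim y∈ | powers-elim z∈
      ... | a , _ , refl | b , _ , refl = subst (λ w → powers w ≡ true) (^-+ x a b) (powers-intro (a + b))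
      ⁻¹-closed : ∀ {y} → powers y ≡ true → powers (y ⁻¹) ≡ true
      ⁻¹-closed y∈ with powers-elim y∈
      ... | a , a<d , refl = subst (λ w → powers w ≡ true) (^-inverse x ^-order (<⇒≤ a<d)) (powers-intro (d ∸ a))

    order-∣-n : d ∣ n
    order-∣-n = subst (_∣ n) #powers (lagrange powers-subgroup)

  ^-n : ∀ x → x ^ n ≡ e
  ^-n x with order x
  ... | k , x-order = ^-∣ x (HasOrder.^-order x-order) (order-∣-n x-order)

  ^-root-5 : ∀ w → w ^ 5 ≡ e → ∀ {d} → 0 < d → d < 5 → (w ^ d) ^ (d * (d * d)) ≡ w
  ^-root-5 w w^5≡e {d} 0<d d<5 = begin
    (w ^ d) ^ (d * (d * d))          ≡⟨ ^-* w d (d * (d * d)) ⟩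
    w ^ (d * (d * (d * d)))          ≡⟨ ^-mod w 5 w^5≡e (d * (d * (d * d))) ⟩
    w ^ ((d * (d * (d * d))) % 5)    ≡⟨ cong (w ^_) (fermat-5 0<d d<5) ⟩
    w ^ 1                            ≡⟨ ^-1 w ⟩
    w                                ∎

  ∙-sandwich : ∀ p q x r s → p ∙ (q ∙ x ∙ r) ∙ s ≡ p ∙ q ∙ x ∙ (r ∙ s)
  ∙-sandwich p q x r s = begin
    p ∙ (q ∙ x ∙ r) ∙ s     ≡⟨ cong (_∙ s) (assoc p (q ∙ x) r) ⟨
    p ∙ (q ∙ x) ∙ r ∙ s     ≡⟨ cong (λ z → z ∙ r ∙ s) (assoc p q x) ⟨
    p ∙ q ∙ x ∙ r ∙ s       ≡⟨ assoc (p ∙ q ∙ x) r s ⟩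
    p ∙ q ∙ x ∙ (r ∙ s)     ∎

  module DoubleCoset {u v : Fin n} {m : ℕ} .{{_ : NonZero m}} (u^m≡e : u ^ m ≡ e) (v-order : HasOrder v m) where
    open HasOrder v-order

    private
      term : Fin n → Fin m × Fin m → Fin n
      term x (a , b) = u ^ toℕ a ∙ x ∙ v ^ toℕ b

    -- double x is the double coset ⟨u⟩ x ⟨v⟩, enumerated through Fin (m * m) ≅ Fin m × Fin m.
    double : Fin n → Fin n → Bool
    double x = Image (term x ∘ remQuot {m} m)

    double-intro : ∀ x a b → double x (u ^ a ∙ x ∙ v ^ b) ≡ true
    double-intro x a b = subst (λ z → double x z ≡ true) term≡ (Image-intro (term x ∘ remQuot {m} m) (combine a′ b′))
      where
      a′ b′ : Fin m
      a′ = fromℕ< (m%n<n a m)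
      b′ = fromℕ< (m%n<n b m)
      term≡ : term x (remQuot {m} m (combine a′ b′)) ≡ u ^ a ∙ x ∙ v ^ b
      term≡ = begin
        term x (remQuot {m} m (combine a′ b′))  ≡⟨ cong (term x) (remQuot-combine a′ b′) ⟩
        u ^ toℕ a′ ∙ x ∙ v ^ toℕ b′         ≡⟨ cong₂ (λ i j → u ^ i ∙ x ∙ v ^ j) (toℕ-fromℕ< (m%n<n a m)) (toℕ-fromℕ< (m%n<n b m)) ⟩
        u ^ (a % m) ∙ x ∙ v ^ (b % m)       ≡⟨ cong₂ (λ y z → y ∙ x ∙ z) (^-mod u m u^m≡e a) (^-mod v m ^-order b) ⟨
        u ^ a ∙ x ∙ v ^ b                   ∎

    double-elim : ∀ {x y} → double x y ≡ true → ∃[ a ] ∃[ b ] (a < m × b < m × u ^ a ∙ x ∙ v ^ b ≡ y)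
    double-elim {x} y∈ with Image-elim (term x ∘ remQuot {m} m) y∈
    ... | i , term≡y = toℕ a , toℕ b , toℕ<n a , toℕ<n b , term≡y
      where
      a b : Fin m
      a = proj₁ (remQuot {m} m i)
      b = proj₂ (remQuot {m} m i)

    double-refl : ∀ x → double x x ≡ true
    double-refl x = subst (λ z → double x z ≡ true) (trans (identityʳ (e ∙ x)) (identityˡ x)) (double-intro x 0 0)

    double-sym : ∀ x y → double x y ≡ true → double y x ≡ true
    double-sym x y y∈ with double-elim y∈
    ... | a , b , a<m , b<m , refl = subst (λ z → double y z ≡ true) x≡ (double-intro y (m ∸ a) (m ∸ b))
      where
      x≡ : u ^ (m ∸ a) ∙ (u ^ a ∙ x ∙ v ^ b) ∙ v ^ (m ∸ b) ≡ x
      x≡ = begin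
        u ^ (m ∸ a) ∙ (u ^ a ∙ x ∙ v ^ b) ∙ v ^ (m ∸ b) ≡⟨ ∙-sandwich _ _ x _ _ ⟩
        u ^ (m ∸ a) ∙ u ^ a ∙ x ∙ (v ^ b ∙ v ^ (m ∸ b))  ≡⟨ cong₂ (λ y z → y ∙ x ∙ z) (^-+ u (m ∸ a) a) (^-+ v b (m ∸ b)) ⟨
        u ^ (m ∸ a + a) ∙ x ∙ v ^ (b + (m ∸ b))          ≡⟨ cong₂ (λ i j → u ^ i ∙ x ∙ v ^ j) (m∸n+n≡m (<⇒≤ a<m)) (m+[n∸m]≡n (<⇒≤ b<m)) ⟩
        u ^ m ∙ x ∙ v ^ m                                ≡⟨ cong₂ (λ y z → y ∙ x ∙ z) u^m≡e ^-order ⟩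
        e ∙ x ∙ e                                        ≡⟨ trans (identityʳ (e ∙ x)) (identityˡ x) ⟩
        x                                                ∎

    double-trans : ∀ x y z → double x y ≡ true → double y z ≡ true → double x z ≡ true
    double-trans x y z y∈ z∈ with double-elim y∈ | double-elim z∈
    ... | a , b , _ , _ , refl | c , d , _ , _ , refl = subst (λ w → double x w ≡ true) z≡ (double-intro x (c + a) (b + d))
      where
      z≡ : u ^ (c + a) ∙ x ∙ v ^ (b + d) ≡ u ^ c ∙ (u ^ a ∙ x ∙ v ^ b) ∙ v ^ d
      z≡ = trans (cong₂ (λ y z → y ∙ x ∙ z) (^-+ u c a) (^-+ v b d)) (sym (∙-sandwich _ _ x _ _))

    private
      conj-shift : ∀ x {a a′ b b′} → a < a′ → b′ ≤ m → u ^ a ∙ x ∙ v ^ b ≡ u ^ a′ ∙ x ∙ v ^ b′ →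
        conj x (u ^ (a′ ∸ a)) ≡ v ^ (b + (m ∸ b′))
      conj-shift x {a} {a′} {b} {b′} a<a′ b′≤m eq = begin
        conj x (u ^ d)                       ≡⟨ assoc (x ⁻¹) (u ^ d) x ⟩
        x ⁻¹ ∙ (u ^ d ∙ x)                    ≡⟨ cong (x ⁻¹ ∙_) (//-rightDividesʳ (v ^ b′) (u ^ d ∙ x)) ⟨
        x ⁻¹ ∙ (u ^ d ∙ x ∙ v ^ b′ ∙ (v ^ b′) ⁻¹) ≡⟨ cong (λ y → x ⁻¹ ∙ (y ∙ (v ^ b′) ⁻¹)) cancelled ⟨
        x ⁻¹ ∙ (x ∙ v ^ b ∙ (v ^ b′) ⁻¹)       ≡⟨ cong (x ⁻¹ ∙_) (assoc x (v ^ b) ((v ^ b′) ⁻¹)) ⟩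
        x ⁻¹ ∙ (x ∙ (v ^ b ∙ (v ^ b′) ⁻¹))     ≡⟨ \\-leftDividesʳ x _ ⟩
        v ^ b ∙ (v ^ b′) ⁻¹                   ≡⟨ cong (v ^ b ∙_) (^-inverse v ^-order b′≤m) ⟨
        v ^ b ∙ v ^ (m ∸ b′)                  ≡⟨ ^-+ v b (m ∸ b′) ⟨
        v ^ (b + (m ∸ b′))                    ∎
        where
        d = a′ ∸ a
        u^a′≡u^a∙u^d : u ^ a′ ≡ u ^ a ∙ u ^ d
        u^a′≡u^a∙u^d = trans (cong (u ^_) (sym (m+[n∸m]≡n (<⇒≤ a<a′)))) (^-+ u a d)
        cancelled : x ∙ v ^ b ≡ u ^ d ∙ x ∙ v ^ b′
        cancelled = ∙-cancelˡ (u ^ a) _ _ (begin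
          u ^ a ∙ (x ∙ v ^ b)           ≡⟨ assoc (u ^ a) x (v ^ b) ⟨
          u ^ a ∙ x ∙ v ^ b             ≡⟨ eq ⟩
          u ^ a′ ∙ x ∙ v ^ b′           ≡⟨ cong (λ y → y ∙ x ∙ v ^ b′) u^a′≡u^a∙u^d ⟩
          u ^ a ∙ u ^ d ∙ x ∙ v ^ b′     ≡⟨ cong (_∙ v ^ b′) (assoc (u ^ a) (u ^ d) x) ⟩
          u ^ a ∙ (u ^ d ∙ x) ∙ v ^ b′   ≡⟨ assoc (u ^ a) (u ^ d ∙ x) (v ^ b′) ⟩
          u ^ a ∙ (u ^ d ∙ x ∙ v ^ b′)   ∎)

    #double : ∀ x → (∀ {d c} → 0 < d → d < m → conj x (u ^ d) ≢ v ^ c) → # (double x) ≡ m * m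
    #double x no-shift = #-image (term x ∘ remQuot {m} m) injective
      where
      term-injective : ∀ {a b a′ b′} → b < m → a′ < m → b′ < m → a < m →
        u ^ a ∙ x ∙ v ^ b ≡ u ^ a′ ∙ x ∙ v ^ b′ → a ≡ a′ × b ≡ b′
      term-injective {a} {b} {a′} {b′} b<m a′<m b′<m a<m eq with <-cmp a a′
      ... | tri< a<a′ _ _ = contradiction (conj-shift x {b = b} {b′} a<a′ (<⇒≤ b′<m) eq)
                              (no-shift {c = b + (m ∸ b′)} (m<n⇒0<n∸m a<a′) (≤-<-trans (m∸n≤m a′ a) a′<m))
      ... | tri> _ _ a′<a = contradiction (conj-shift x {b = b′} {b} a′<a (<⇒≤ b<m) (sym eq))
                              (no-shift {c = b′ + (m ∸ b)} (m<n⇒0<n∸m a′<a) (≤-<-trans (m∸n≤m a a′) a<m))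
      ... | tri≈ _ refl _ = refl , ^-injective v-order b<m b′<m (∙-cancelˡ (u ^ a ∙ x) _ _ eq)
      injective : ∀ i j → term x (remQuot {m} m i) ≡ term x (remQuot {m} m j) → i ≡ j
      injective i j eq with term-injective (toℕ<n b) (toℕ<n a′) (toℕ<n b′) (toℕ<n a) eq
        where
        a b a′ b′ : Fin m
        a = proj₁ (remQuot {m} m i)
        b = proj₂ (remQuot {m} m i)
        a′ = proj₁ (remQuot {m} m j)
        b′ = proj₂ (remQuot {m} m j)
      ... | a≡a′ , b≡b′ = begin
        i                                  ≡⟨ combine-remQuot {m} m i ⟨
        uncurry combine (remQuot {m} m i)  ≡⟨ cong (uncurry combine) (cong₂ _,_ (toℕ-injective a≡a′) (toℕ-injective b≡b′)) ⟩
        uncurry combine (remQuot {m} m j)  ≡⟨ combine-remQuot {m} m j ⟩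
        j                                  ∎

    double-e-subgroup : u ∙ v ≡ v ∙ u → IsSubgroup (double e)
    double-e-subgroup uv≡vu = record
      { e∈ = double-refl e
      ; ∙-closed = ∙-closed
      ; ⁻¹-closed = ⁻¹-closed
      }
      where
      drop-e : ∀ a b → u ^ a ∙ e ∙ v ^ b ≡ u ^ a ∙ v ^ b
      drop-e a b = cong (_∙ v ^ b) (identityʳ (u ^ a))
      ∙-closed : ∀ {y z} → double e y ≡ true → double e z ≡ true → double e (y ∙ z) ≡ true
      ∙-closed y∈ z∈ with double-elim y∈ | double-elim z∈
      ... | a , b , _ , _ , refl | c , d , _ , _ , refl =
        subst (λ w → double e w ≡ true) product (double-intro e (a + c) (b + d))
        where
        product : u ^ (a + c) ∙ e ∙ v ^ (b + d) ≡ (u ^ a ∙ e ∙ v ^ b) ∙ (u ^ c ∙ e ∙ v ^ d)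
        product = begin
          u ^ (a + c) ∙ e ∙ v ^ (b + d)             ≡⟨ cong₂ (λ y z → y ∙ e ∙ z) (^-+ u a c) (^-+ v b d) ⟩
          u ^ a ∙ u ^ c ∙ e ∙ (v ^ b ∙ v ^ d)       ≡⟨ ∙-sandwich (u ^ a) (u ^ c) e (v ^ b) (v ^ d) ⟨
          u ^ a ∙ (u ^ c ∙ e ∙ v ^ b) ∙ v ^ d       ≡⟨ cong (λ y → u ^ a ∙ y ∙ v ^ d) (trans (drop-e c b) (^-comm² uv≡vu c b)) ⟩
          u ^ a ∙ (v ^ b ∙ u ^ c) ∙ v ^ d           ≡⟨ cong (_∙ v ^ d) (assoc (u ^ a) (v ^ b) (u ^ c)) ⟨
          u ^ a ∙ v ^ b ∙ u ^ c ∙ v ^ d             ≡⟨ assoc (u ^ a ∙ v ^ b) (u ^ c) (v ^ d) ⟩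
          u ^ a ∙ v ^ b ∙ (u ^ c ∙ v ^ d)           ≡⟨ cong₂ _∙_ (drop-e a b) (drop-e c d) ⟨
          u ^ a ∙ e ∙ v ^ b ∙ (u ^ c ∙ e ∙ v ^ d)   ∎
      ⁻¹-closed : ∀ {y} → double e y ≡ true → double e (y ⁻¹) ≡ true
      ⁻¹-closed y∈ with double-elim y∈
      ... | a , b , a<m , b<m , refl = subst (λ w → double e w ≡ true) inverse (double-intro e (m ∸ a) (m ∸ b))
        where
        inverse : u ^ (m ∸ a) ∙ e ∙ v ^ (m ∸ b) ≡ (u ^ a ∙ e ∙ v ^ b) ⁻¹
        inverse = begin
          u ^ (m ∸ a) ∙ e ∙ v ^ (m ∸ b)   ≡⟨ drop-e (m ∸ a) (m ∸ b) ⟩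
          u ^ (m ∸ a) ∙ v ^ (m ∸ b)       ≡⟨ ^-comm² uv≡vu (m ∸ a) (m ∸ b) ⟩
          v ^ (m ∸ b) ∙ u ^ (m ∸ a)       ≡⟨ cong₂ _∙_ (^-inverse v ^-order (<⇒≤ b<m)) (^-inverse u u^m≡e (<⇒≤ a<m)) ⟩
          (v ^ b) ⁻¹ ∙ (u ^ a) ⁻¹         ≡⟨ ⁻¹-anti-homo-∙ (u ^ a) (v ^ b) ⟨
          (u ^ a ∙ v ^ b) ⁻¹              ≡⟨ cong _⁻¹ (drop-e a b) ⟨
          (u ^ a ∙ e ∙ v ^ b) ⁻¹          ∎

module NeumaierClique {n : ℕ} (A : Graph n)
  (A-sym : ∀ x y → A x y ≡ A y x) (A-irrefl : ∀ x → A x x ≡ false)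
  {k λ′ c : ℕ} (edgeRegular : IsEdgeRegular A k λ′)
  (2c<k : c + c < k) (k≤2c+λ : k ≤ c + c + λ′)
  where

  open Counting
  open import Data.Bool using (_∧_)
  open import Data.Nat using (s≤s)
  open import Data.Nat.Properties using (≤-trans; 1+n≰n; +-cancelˡ-≤; +-assoc; +-identityʳ; <-irrefl)
  open import Data.Fin using (Fin)
  open import Data.Product using (∃-syntax; proj₁; proj₂)
  open import Data.Empty using (⊥; ⊥-elim)
  open import Function using (_∘_)
  open import Relation.Binary.PropositionalEquality

  adjacent⇒≢ : ∀ {x y} → A x y ≡ true → x ≢ y
  adjacent⇒≢ {x} Axy refl = true≢false Axy (A-irrefl x)

  module _ {K : Fin n → Bool} (K-regular : IsRegularClique A K 1) where

    no-two-neighbours : ∀ {x a b} → K x ≡ false → K a ≡ true → K b ≡ true → a ≢ b →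
      A x a ≡ true → A x b ≡ true → ⊥
    no-two-neighbours {x} Kx Ka Kb a≢b Axa Axb = 1+n≰n (subst (2 ≤_) (proj₂ K-regular x Kx)
      (2≤# (K ∩ A x) (∩-intro K (A x) Ka Axa) (∩-intro K (A x) Kb Axb) a≢b))

    #neighbours-in-clique : ∀ {v} → K v ≡ true → # K ≡ suc c → # (A v ∩ K) ≡ c
    #neighbours-in-clique {v} Kv #K≡1+c = trans (#-cong Av∩K≗K-v) (#-without K Kv #K≡1+c)
      where
      Av∩K≗K-v : ∀ z → (A v ∩ K) z ≡ (K without v) z
      Av∩K≗K-v z = ≡true-ext
        (λ h → without-intro K (∩-elimʳ (A v) K h) (adjacent⇒≢ (∩-elimˡ (A v) K h) ∘ sym))
        (λ h → ∩-intro (A v) K (proj₁ K-regular v z Kv (without-elimˡ K h) (without-elimʳ K h ∘ sym))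
                               (without-elimˡ K h))

  module _ {K D : Fin n → Bool}
    (K-regular : IsRegularClique A K 1) (#K : # K ≡ suc c)
    (D-regular : IsRegularClique A D 1) (#D : # D ≡ suc c)
    {v : Fin n} (Kv : K v ≡ true) (Dv : D v ≡ true)
    where

    private
      module Outside {y : Fin n} (Dy : D y ≡ true) (Ky : K y ≡ false) where
        open ≡-Reasoning

        N X : Fin n → Bool
        N = A v
        X = (N ∖ K) ∖ D

        D-v∩K≡∅ : ∀ {z} → D z ≡ true → z ≢ v → K z ≡ false
        D-v∩K≡∅ {z} Dz z≢v with K z in Kz
        ... | false = refl
        ... | true  = ⊥-elim (no-two-neighbours K-regular Ky Kv Kz (z≢v ∘ sym)
                       (proj₁ D-regular y v Dy Dv λ { refl → true≢false Kv Ky })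
                       (proj₁ D-regular y z Dy Dz λ { refl → true≢false Kz Ky }))

        N∖K∩D≗D-v : ∀ z → ((N ∖ K) ∩ D) z ≡ (D without v) z
        N∖K∩D≗D-v z = ≡true-ext
          (λ h → without-intro D (∩-elimʳ (N ∖ K) D h) (adjacent⇒≢ (∖-elimˡ N K (∩-elimˡ (N ∖ K) D h)) ∘ sym))
          (λ h → ∩-intro (N ∖ K) D
            (∖-intro N K (proj₁ D-regular v z Dv (without-elimˡ D h) (without-elimʳ D h ∘ sym))
                         (D-v∩K≡∅ (without-elimˡ D h) (without-elimʳ D h)))
            (without-elimˡ D h))

        k≡c+[c+#X] : k ≡ c + (c + # X)
        k≡c+[c+#X] = begin
          k                               ≡⟨ proj₁ edgeRegular v ⟨
          # N                             ≡⟨ #-split N K ⟩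
          # (N ∩ K) + # (N ∖ K)           ≡⟨ cong₂ _+_ (#neighbours-in-clique K-regular Kv #K) (#-split (N ∖ K) D) ⟩
          c + (# ((N ∖ K) ∩ D) + # X)     ≡⟨ cong (λ m → c + (m + # X)) (#-cong N∖K∩D≗D-v) ⟩
          c + (# (D without v) + # X)     ≡⟨ cong (λ m → c + (m + # X)) (#-without D Dv #D) ⟩
          c + (c + # X)                   ∎

        #X≤λ′ : # X ≤ λ′
        #X≤λ′ = +-cancelˡ-≤ c _ _ (+-cancelˡ-≤ c _ _
          (subst (_≤ c + (c + λ′)) k≡c+[c+#X] (subst (k ≤_) (+-assoc c c λ′) k≤2c+λ)))

        #X≢0 : # X ≢ 0
        #X≢0 #X≡0 = <-irrefl (sym k≡c+c) 2c<k
          where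
          k≡c+c : k ≡ c + c
          k≡c+c = trans k≡c+[c+#X] (trans (cong (λ m → c + (c + m)) #X≡0) (cong (c +_) (+-identityʳ c)))

        r-witness : ∃[ r ] X r ≡ true
        r-witness = #≢0⇒∃ X #X≢0

        r : Fin n
        r = proj₁ r-witness

        Avr : A v r ≡ true
        Avr = ∖-elimˡ N K (∖-elimˡ (N ∖ K) D (proj₂ r-witness))

        outside : ∀ {C} → IsRegularClique A C 1 → C v ≡ true → C r ≡ false →
          ∀ {z} → A v z ≡ true → A z r ≡ true → C z ≡ false
        outside {C} C-regular Cv Cr {z} Avz Azr with C z in Cz
        ... | false = refl
        ... | true  = ⊥-elim (no-two-neighbours C-regular Cr Cv Cz (adjacent⇒≢ Avz)
                        (trans (A-sym r v) Avr) (trans (A-sym r z) Azr))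

        common⊆X-r : (λ z → A v z ∧ A z r) ⊆ (X without r)
        common⊆X-r z h = without-intro X
          (∖-intro (N ∖ K) D
            (∖-intro N K Avz (outside K-regular Kv (∖-elimʳ N K (∖-elimˡ (N ∖ K) D (proj₂ r-witness))) Avz Azr))
            (outside D-regular Dv (∖-elimʳ (N ∖ K) D (proj₂ r-witness)) Avz Azr))
          (adjacent⇒≢ Azr)
          where
          Avz : A v z ≡ true
          Avz = ∩-elimˡ (A v) (λ w → A w r) h
          Azr : A z r ≡ true
          Azr = ∩-elimʳ (A v) (λ w → A w r) h

        λ′<#X : λ′ < # X
        λ′<#X = subst (suc λ′ ≤_) (sym (#-remove X (proj₂ r-witness)))
          (s≤s (subst (_≤ # (X without r)) (proj₂ edgeRegular v r Avr) (#-mono common⊆X-r)))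

    meeting-cliques-⊆ : D ⊆ K
    meeting-cliques-⊆ y Dy with K y in Ky
    ... | true  = refl
    ... | false = ⊥-elim (1+n≰n (≤-trans λ′<#X #X≤λ′))
      where open Outside Dy Ky

module CayleyGraph {n : ℕ} {_·_ : Op₂ (Fin n)} {ε : Fin n} {_⁻¹′ : Op₁ (Fin n)}
  (isGroup : IsGroup _≡_ _·_ ε _⁻¹′)
  (S : Subset n) (e∉S : ε ∉ S) (S-sym : ∀ s → s ∈ S → (s ⁻¹′) ∈ S)
  where

  open Counting
  open FiniteGroup isGroup
  open import Data.Bool using (Bool; true; false; _∧_)
  open import Data.Bool.Properties using (∧-comm)
  open import Data.Nat using (suc; _+_; _≤_; _<_)
  open import Data.Fin.Subset.Properties using (_∈?_)
  open import Data.Product using (∃-syntax; _,_; proj₁; proj₂)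
  open import Function using (_∘_)
  open import Relation.Nullary using (does)
  open import Relation.Nullary.Decidable using (dec-true; dec-false)
  open import Relation.Binary.PropositionalEquality

  Γ : Graph n
  Γ = Cay _∙_ _⁻¹ S

  inS : Fin n → Bool
  inS z = does (z ∈? S)

  inS-e : inS e ≡ false
  inS-e = dec-false (e ∈? S) e∉S

  inS-⁻¹ : ∀ z → inS (z ⁻¹) ≡ inS z
  inS-⁻¹ z = ≡true-ext (λ h → subst (λ w → inS w ≡ true) (⁻¹-involutive z) (S-sym′ h)) S-sym′
    where
    S-sym′ : ∀ {w} → inS w ≡ true → inS (w ⁻¹) ≡ true
    S-sym′ {w} h = dec-true ((w ⁻¹) ∈? S) (S-sym w (does-true⇒ (w ∈? S) h))

  Γ-sym : ∀ x y → Γ x y ≡ Γ y x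
  Γ-sym x y = trans (sym (inS-⁻¹ (x ∙ y ⁻¹))) (cong inS (⁻¹-anti-homo-// x y))

  Γ-irrefl : ∀ x → Γ x x ≡ false
  Γ-irrefl x = trans (cong inS (inverseʳ x)) inS-e

  Γ-e : ∀ x → Γ x e ≡ inS x
  Γ-e x = cong inS (trans (cong (x ∙_) ε⁻¹≈ε) (identityʳ x))

  Γ-translate : ∀ a x y → Γ (x ∙ a) (y ∙ a) ≡ Γ x y
  Γ-translate a x y = cong inS (begin
    (x ∙ a) ∙ (y ∙ a) ⁻¹     ≡⟨ cong ((x ∙ a) ∙_) (⁻¹-anti-homo-∙ y a) ⟩
    (x ∙ a) ∙ (a ⁻¹ ∙ y ⁻¹)  ≡⟨ assoc x a _ ⟩
    x ∙ (a ∙ (a ⁻¹ ∙ y ⁻¹))  ≡⟨ cong (x ∙_) (\\-leftDividesˡ a (y ⁻¹)) ⟩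
    x ∙ y ⁻¹                 ∎)
    where open ≡-Reasoning

  translate-regularClique : ∀ {C m} a → IsRegularClique Γ C m → IsRegularClique Γ (C ∘ (_∙ a)) m
  translate-regularClique {C} {m} a (C-clique , C-nexus) = clique , nexus
    where
    clique : IsClique Γ (C ∘ (_∙ a))
    clique y z Cy Cz y≢z = trans (sym (Γ-translate a y z))
      (C-clique (y ∙ a) (z ∙ a) Cy Cz λ eq → y≢z (∙-cancelʳ a y z eq))
    nexus : ∀ y → C (y ∙ a) ≡ false → # (λ z → C (z ∙ a) ∧ Γ y z) ≡ m
    nexus y Cya = begin
      # (λ z → C (z ∙ a) ∧ Γ y z)          ≡⟨ #-cong (λ z → cong (C (z ∙ a) ∧_) (sym (Γ-translate a y z))) ⟩
      # ((λ w → C w ∧ Γ (y ∙ a) w) ∘ (_∙ a)) ≡⟨ #-∘-inverse _ (_∙ a) (_∙ a ⁻¹) (//-rightDividesʳ a) (//-rightDividesˡ a) ⟩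
      # (λ w → C w ∧ Γ (y ∙ a) w)          ≡⟨ C-nexus (y ∙ a) Cya ⟩
      m                                    ∎
      where open ≡-Reasoning

  #-translate : ∀ (C : Fin n → Bool) a → # (C ∘ (_∙ a)) ≡ # C
  #-translate C a = #-∘-inverse C (_∙ a) (_∙ a ⁻¹) (//-rightDividesʳ a) (//-rightDividesˡ a)

  module CliqueSubgroup {k λ′ c : ℕ} (edgeRegular : IsEdgeRegular Γ k λ′)
    (2c<k : c + c < k) (k≤2c+λ : k ≤ c + c + λ′)
    {C : Fin n → Bool} (C-regular : IsRegularClique Γ C 1) (#C : # C ≡ suc c)
    where
    open NeumaierClique Γ Γ-sym Γ-irrefl {c = c} edgeRegular 2c<k k≤2c+λ using (meeting-cliques-⊆)

    private
      C-inhabited : ∃[ c₀ ] C c₀ ≡ true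
      C-inhabited = #≡1+n⇒∃ C #C
      c₀ : Fin n
      c₀ = proj₁ C-inhabited

    H : Fin n → Bool
    H = C ∘ (_∙ c₀)

    H-regular : IsRegularClique Γ H 1
    H-regular = translate-regularClique c₀ C-regular

    #H : # H ≡ suc c
    #H = trans (#-translate C c₀) #C

    private
      translates-meeting-H-⊆ : ∀ g {v} → H v ≡ true → H (v ∙ g) ≡ true → ∀ {y} → H (y ∙ g) ≡ true → H y ≡ true
      translates-meeting-H-⊆ g Hv Hvg {y} =
        meeting-cliques-⊆ H-regular #H (translate-regularClique g H-regular) (trans (#-translate H g) #H) Hv Hvg y

    H-subgroup : IsSubgroup H
    H-subgroup = record { e∈ = e∈ ; ∙-closed = ∙-closed ; ⁻¹-closed = ⁻¹-closed }
      where
      e∈ : H e ≡ true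
      e∈ = trans (cong C (identityˡ c₀)) (proj₂ C-inhabited)
      ∙-closed : ∀ {a b} → H a ≡ true → H b ≡ true → H (a ∙ b) ≡ true
      ∙-closed {a} {b} Ha Hb = translates-meeting-H-⊆ (b ⁻¹) Hb (trans (cong H (inverseʳ b)) e∈)
        (trans (cong H (//-rightDividesʳ b a)) Ha)
      ⁻¹-closed : ∀ {b} → H b ≡ true → H (b ⁻¹) ≡ true
      ⁻¹-closed {b} Hb = translates-meeting-H-⊆ b e∈ (trans (cong H (identityˡ b)) Hb)
        (trans (cong H (inverseˡ b)) e∈)

    coset-meets-S-once : ∀ x → H x ≡ false → # (λ s → inS s ∧ H (x ⁻¹ ∙ s)) ≡ 1
    coset-meets-S-once x Hx = begin
      # (λ s → inS s ∧ H (x ⁻¹ ∙ s))                   ≡⟨ #-∘-inverse _ (λ z → x ∙ z ⁻¹) (λ s → s ⁻¹ ∙ x) back forth ⟨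
      # (λ z → inS (x ∙ z ⁻¹) ∧ H (x ⁻¹ ∙ (x ∙ z ⁻¹))) ≡⟨ #-cong swap ⟩
      # (λ z → H z ∧ Γ x z)                             ≡⟨ proj₂ H-regular x Hx ⟩
      1                                                 ∎
      where
      open ≡-Reasoning
      open IsSubgroup H-subgroup using (⁻¹-∈)
      swap : ∀ z → inS (x ∙ z ⁻¹) ∧ H (x ⁻¹ ∙ (x ∙ z ⁻¹)) ≡ H z ∧ Γ x z
      swap z = trans (cong (inS (x ∙ z ⁻¹) ∧_) (trans (cong H (\\-leftDividesʳ x (z ⁻¹))) (⁻¹-∈ z)))
                     (∧-comm (inS (x ∙ z ⁻¹)) (H z))
      back : ∀ z → (x ∙ z ⁻¹) ⁻¹ ∙ x ≡ z
      back z = trans (cong (_∙ x) (⁻¹-anti-homo-// x z)) (//-rightDividesˡ x z)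
      forth : ∀ s → x ∙ (s ⁻¹ ∙ x) ⁻¹ ≡ s
      forth s = trans (cong (x ∙_) (⁻¹-anti-homo-\\ s x)) (\\-leftDividesˡ x s)

module GroupOfOrder35 {_·_ : Op₂ (Fin 35)} {ε : Fin 35} {_⁻¹′ : Op₁ (Fin 35)}
  (isGroup : IsGroup _≡_ _·_ ε _⁻¹′)
  where
  open FiniteGroup isGroup
  open Counting
  open Arithmetic
  open import Data.Bool using (Bool; true; false; not)
  open import Data.Nat using (ℕ; zero; suc; _+_; _*_; _%_; _≤_; _<_; s≤s; z≤n; NonZero)
  import Data.Nat as ℕ
  open import Data.Nat.Properties using (+-cancelˡ-≡; *-comm)
  open import Data.Nat.Divisibility using (_∣_; divides; ∣-trans; n∣m⇒m%n≡0)
  open import Data.Nat.DivMod using (m%n<n)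
  open import Data.Product using (∃-syntax; Σ-syntax; _×_; _,_; proj₁; proj₂)
  open import Function using (_∘_)
  open import Relation.Nullary using (¬_; contradiction)
  open import Relation.Binary.PropositionalEquality
  open ≡-Reasoning

  subgroup-of-order-5 : ∀ {K} → IsSubgroup K → # K ≡ 5 →
    ∃[ h ] Σ[ h-order ∈ HasOrder h 5 ] ∀ x → K x ≡ powers h-order x
  subgroup-of-order-5 {K} K-subgroup #K = h , h-order , K≗powers
    where
    open IsSubgroup K-subgroup
    nontrivial : ∃[ h ] (K without e) h ≡ true
    nontrivial = #≡1+n⇒∃ (K without e) (#-without K e∈ #K)
    h : Fin 35
    h = proj₁ nontrivial
    powers⊆K : ∀ {d} .{{_ : NonZero d}} (h-order : HasOrder h d) → powers h-order ⊆ K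
    powers⊆K h-order y y∈ = K∋ (powers-elim h-order y∈)
      where K∋ : ∃[ i ] (_ × h ^ i ≡ y) → K y ≡ true
            K∋ (i , _ , refl) = ^-closed (without-elimˡ K (proj₂ nontrivial)) i
    order-5 : ∃[ k ] HasOrder h (suc k) → HasOrder h 5
    order-5 (k , h-order) = subst (HasOrder h) (∣35∧≤5⇒≡5 (order-∣-n h-order) 1+k≤5 1+k≢1) h-order
      where
      1+k≤5 : suc k ≤ 5
      1+k≤5 = subst₂ _≤_ (#powers h-order) #K (#-mono (powers⊆K h-order))
      1+k≢1 : suc k ≢ 1
      1+k≢1 refl = without-elimʳ K (proj₂ nontrivial) (trans (sym (^-1 h)) (HasOrder.^-order h-order))
    h-order : HasOrder h 5
    h-order = order-5 (order h)
    K≗powers : ∀ x → K x ≡ powers h-order x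
    K≗powers x = ≡true-ext (⊆∧#≡⇒⊇ (powers⊆K h-order) (trans (#powers h-order) (sym #K)) x) (powers⊆K h-order x)

  module Generator {h : Fin 35} (h-order : HasOrder h 5) where

    open HasOrder h-order using () renaming (^-order to h^5≡e)

    H : Fin 35 → Bool
    H = powers h-order

    open IsSubgroup (powers-subgroup h-order)

    H∋h^ : ∀ i → H (h ^ i) ≡ true
    H∋h^ = powers-intro h-order

    #H : # H ≡ 5
    #H = #powers h-order

    H-^5 : ∀ {x} → H x ≡ true → x ^ 5 ≡ e
    H-^5 Hx with powers-elim h-order Hx
    ... | i , _ , refl = trans (^-* h i 5) (^-∣ h h^5≡e (divides i refl))

    normalises : Fin 35 → Bool
    normalises x = H (conj x h)

    private
      module hxh = DoubleCoset h^5≡e h-order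

      normalises-∙H : ∀ x {k} → H k ≡ true → normalises (x ∙ k) ≡ normalises x
      normalises-∙H x {k} Hk = trans (cong H (conj-∙ˡ x k h)) (conj-∈ (conj x h) Hk)

      normalises-h^∙ : ∀ a x → normalises (h ^ a ∙ x) ≡ normalises x
      normalises-h^∙ a x = cong H (trans (conj-∙ˡ (h ^ a) x h) (cong (conj x) (comm⇒conj-fixed (sym (^-comm {h} {h} refl a)))))

      normalises-double : ∀ {x y} → hxh.double x y ≡ true → normalises y ≡ normalises x
      normalises-double {x} y∈ with hxh.double-elim y∈
      ... | a , b , _ , _ , refl = trans (normalises-∙H (h ^ a ∙ x) (H∋h^ b)) (normalises-h^∙ a x)

      H-conj-root : ∀ x {d} → 0 < d → d < 5 → H (conj x (h ^ d)) ≡ true → normalises x ≡ true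
      H-conj-root x {d} 0<d d<5 H∋conj = subst (λ y → H (conj x y) ≡ true) (^-root-5 h h^5≡e 0<d d<5)
        (subst (λ y → H y ≡ true) (conj-^ x (h ^ d) (d * (d * d))) (^-closed H∋conj (d * (d * d))))

      -- An element x with x⁻¹hx ∉ H has a double coset ⟨h⟩x⟨h⟩ of size 25.
      25∣#non-normalising : 25 ∣ # (not ∘ normalises)
      25∣#non-normalising = classes-∣ hxh.double hxh.double-refl hxh.double-sym hxh.double-trans 25 (not ∘ normalises) class-size
        where
        class-size : ∀ x → not (normalises x) ≡ true → # ((not ∘ normalises) ∩ hxh.double x) ≡ 25
        class-size x ¬Nx = trans (#-cong same) (hxh.#double x λ {d} {c} → no-shift {d} {c})
          where
          same : ∀ y → ((not ∘ normalises) ∩ hxh.double x) y ≡ hxh.double x y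
          same y = ≡true-ext (∩-elimʳ (not ∘ normalises) (hxh.double x))
            λ y∈ → ∩-intro (not ∘ normalises) (hxh.double x) (trans (cong not (normalises-double y∈)) ¬Nx) y∈
          no-shift : ∀ {d c} → 0 < d → d < 5 → conj x (h ^ d) ≢ h ^ c
          no-shift {d} {c} 0<d d<5 eq = true≢false (H-conj-root x 0<d d<5 (subst (λ y → H y ≡ true) (sym eq) (H∋h^ c)))
                                                   (not-elim ¬Nx)

      H∋h : H h ≡ true
      H∋h = subst (λ y → H y ≡ true) (^-1 h) (H∋h^ 1)

      H⊆normalises : H ⊆ normalises
      H⊆normalises x Hx = conj-closed Hx H∋h

      #normalises≡5+ : # normalises ≡ 5 + # (normalises ∖ H)
      #normalises≡5+ = trans (#-split normalises H) (cong (_+ # (normalises ∖ H)) (trans (#-cong N∩H≗H) #H))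
        where
        N∩H≗H : ∀ y → (normalises ∩ H) y ≡ H y
        N∩H≗H y = ≡true-ext (∩-elimʳ normalises H) λ Hy → ∩-intro normalises H (H⊆normalises y Hy) Hy

    -- Otherwise the 35 − 5 = 30 elements that do not normalise H would split into double cosets of size 25.
    -- (Abstract for the same reason as #≢0⇒∃.)
    abstract
      normaliser-outside-H : ∃[ t ] (normalises ∖ H) t ≡ true
      normaliser-outside-H = #≢0⇒∃ (normalises ∖ H) λ #≡0 →
        25∤30 (subst (25 ∣_) (#non-normalising≡30 #≡0) 25∣#non-normalising)
        where
        25∤30 : ¬ 25 ∣ 30
        25∤30 25∣30 = contradiction (n∣m⇒m%n≡0 30 25 25∣30) λ ()
        #non-normalising≡30 : # (normalises ∖ H) ≡ 0 → # (not ∘ normalises) ≡ 30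
        #non-normalising≡30 #≡0 = +-cancelˡ-≡ 5 _ _ (begin
          5 + # (not ∘ normalises)                  ≡⟨ cong (λ m → m + # (not ∘ normalises)) (trans #normalises≡5+ (cong (5 +_) #≡0)) ⟨
          # normalises + # (not ∘ normalises)       ≡⟨ #-split (λ _ → true) normalises ⟨
          # (λ (_ : Fin 35) → true)                 ≡⟨ #-all ⟩
          35                                        ∎)

    t : Fin 35
    t = proj₁ normaliser-outside-H

    private
      t-normalises : normalises t ≡ true
      t-normalises = ∖-elimˡ normalises H (proj₂ normaliser-outside-H)

      t∉H : H t ≡ false
      t∉H = ∖-elimʳ normalises H (proj₂ normaliser-outside-H)

      j : ℕ
      j = proj₁ (powers-elim h-order t-normalises)

      j<5 : j < 5
      j<5 = proj₁ (proj₂ (powers-elim h-order t-normalises))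

      h^j≡conj-t-h : h ^ j ≡ conj t h
      h^j≡conj-t-h = proj₂ (proj₂ (powers-elim h-order t-normalises))

      conj-t^-h : ∀ k → conj (t ^ k) h ≡ h ^ (j ℕ.^ k)
      conj-t^-h zero    = trans (conj-identity h) (sym (^-1 h))
      conj-t^-h (suc k) = begin
        conj (t ∙ t ^ k) h       ≡⟨ conj-∙ˡ t (t ^ k) h ⟩
        conj (t ^ k) (conj t h)  ≡⟨ cong (conj (t ^ k)) h^j≡conj-t-h ⟨
        conj (t ^ k) (h ^ j)     ≡⟨ conj-^ (t ^ k) h j ⟨
        conj (t ^ k) h ^ j       ≡⟨ cong (_^ j) (conj-t^-h k) ⟩
        (h ^ (j ℕ.^ k)) ^ j      ≡⟨ ^-* h (j ℕ.^ k) j ⟩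
        h ^ (j ℕ.^ k * j)        ≡⟨ cong (h ^_) (*-comm (j ℕ.^ k) j) ⟩
        h ^ (j * j ℕ.^ k)        ∎

      j≡1 : j ≡ 1
      j≡1 = ^35≡1-mod-5 j<5 (^-injective h-order (m%n<n (j ℕ.^ 35) 5) (s≤s (s≤s z≤n)) (begin
        h ^ ((j ℕ.^ 35) % 5)  ≡⟨ ^-mod h 5 h^5≡e (j ℕ.^ 35) ⟨
        h ^ (j ℕ.^ 35)        ≡⟨ conj-t^-h 35 ⟨
        conj (t ^ 35) h       ≡⟨ cong (λ w → conj w h) (^-n t) ⟩
        conj e h              ≡⟨ conj-identity h ⟩
        h                     ≡⟨ ^-1 h ⟨
        h ^ 1                 ∎))

    t∙h≡h∙t : t ∙ h ≡ h ∙ t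
    t∙h≡h∙t = sym (conj-fixed⇒comm (trans (sym h^j≡conj-t-h) (trans (cong (h ^_) j≡1) (^-1 h))))

    t^5≢e : t ^ 5 ≢ e
    t^5≢e t^5≡e = 25∤35 (subst (_∣ 35) (txh.#double e λ {d} {c} → no-shift {d} {c}) (lagrange (txh.double-e-subgroup t∙h≡h∙t)))
      where
      module txh = DoubleCoset t^5≡e h-order
      25∤35 : ¬ 25 ∣ 35
      25∤35 25∣35 = contradiction (n∣m⇒m%n≡0 35 25 25∣35) λ ()
      no-shift : ∀ {d c} → 0 < d → d < 5 → conj e (t ^ d) ≢ h ^ c
      no-shift {d} {c} 0<d d<5 eq = true≢false H∋t t∉H
        where
        H∋t^d : H (t ^ d) ≡ true
        H∋t^d = subst (λ y → H y ≡ true) (trans (sym eq) (conj-identity (t ^ d))) (H∋h^ c)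
        H∋t : H t ≡ true
        H∋t = subst (λ y → H y ≡ true) (^-root-5 t t^5≡e 0<d d<5) (^-closed H∋t^d (d * (d * d)))

    private
      y : Fin 35
      y = t ^ 5

      y^7≡e : y ^ 7 ≡ e
      y^7≡e = trans (^-* t 5 7) (^-n t)

      y-order : HasOrder y 7
      y-order with order y
      ... | k , y-order = subst (HasOrder y) (∣7⇒≡7 (HasOrder.order-∣ y-order y^7≡e) 1+k≢1) y-order
        where
        1+k≢1 : suc k ≢ 1
        1+k≢1 refl = t^5≢e (trans (sym (^-1 y)) (HasOrder.^-order y-order))

      h∙y≡y∙h : h ∙ y ≡ y ∙ h
      h∙y≡y∙h = sym (^-comm t∙h≡h∙t 5)

    g : Fin 35
    g = h ∙ y

    private
      g^ : ∀ k → g ^ k ≡ h ^ k ∙ y ^ k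
      g^ = ^-∙-distrib h∙y≡y∙h

      h^[5m]≡e : ∀ m → h ^ (5 * m) ≡ e
      h^[5m]≡e m = ^-∣ h h^5≡e (divides m (*-comm 5 m))

      y^[7m]≡e : ∀ m → y ^ (7 * m) ≡ e
      y^[7m]≡e m = ^-∣ y y^7≡e (divides m (*-comm 7 m))

    g-order : HasOrder g 35
    g-order = record { ^-order = g^35≡e ; order-∣ = 35∣ }
      where
      g^35≡e : g ^ 35 ≡ e
      g^35≡e = trans (g^ 35) (trans (cong₂ _∙_ (h^[5m]≡e 7) (y^[7m]≡e 5)) (identityˡ e))
      35∣ : ∀ {m} → g ^ m ≡ e → 35 ∣ m
      35∣ {m} g^m≡e = 5∣m∧7∣m⇒35∣m (5∣7*m⇒5∣m (HasOrder.order-∣ h-order h^[7m]≡e)) (7∣5*m⇒7∣m (HasOrder.order-∣ y-order y^[5m]≡e))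
        where
        g^[km]≡e : ∀ k → g ^ (k * m) ≡ e
        g^[km]≡e k = ^-∣ g g^m≡e (divides k refl)
        y^[5m]≡e : y ^ (5 * m) ≡ e
        y^[5m]≡e = begin
          y ^ (5 * m)                ≡⟨ identityˡ (y ^ (5 * m)) ⟨
          e ∙ y ^ (5 * m)            ≡⟨ cong (_∙ y ^ (5 * m)) (h^[5m]≡e m) ⟨
          h ^ (5 * m) ∙ y ^ (5 * m)  ≡⟨ g^ (5 * m) ⟨
          g ^ (5 * m)                ≡⟨ g^[km]≡e 5 ⟩
          e                          ∎
        h^[7m]≡e : h ^ (7 * m) ≡ e
        h^[7m]≡e = begin
          h ^ (7 * m)                ≡⟨ identityʳ (h ^ (7 * m)) ⟨
          h ^ (7 * m) ∙ e            ≡⟨ cong (h ^ (7 * m) ∙_) (y^[7m]≡e m) ⟨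
          h ^ (7 * m) ∙ y ^ (7 * m)  ≡⟨ g^ (7 * m) ⟨
          g ^ (7 * m)                ≡⟨ g^[km]≡e 7 ⟩
          e                          ∎

    H∋g^⇒7∣ : ∀ i → H (g ^ i) ≡ true → 7 ∣ i
    H∋g^⇒7∣ i H∋g^i = 7∣5*m⇒7∣m (subst (7 ∣_) (*-comm i 5) (∣-trans (divides 5 refl) 35∣i*5))
      where
      35∣i*5 : 35 ∣ i * 5
      35∣i*5 = HasOrder.order-∣ g-order (trans (sym (^-* g i 5)) (H-^5 H∋g^i))

    H∋g^7k : ∀ k → H (g ^ (7 * k)) ≡ true
    H∋g^7k k = subst (λ z → H z ≡ true) (sym (trans (g^ (7 * k)) (trans (cong (h ^ (7 * k) ∙_) (y^[7m]≡e k)) (identityʳ _))))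
      (H∋h^ (7 * k))

module Z35 where

  open Counting
  open import Data.Bool using (Bool; true; false; _∧_; not)
  open import Data.Nat using (ℕ; zero; suc; _+_; _∸_; _%_; _<_; s≤s)
  open import Data.Nat.Properties using (1+n≰n)
  open import Data.Empty using (⊥; ⊥-elim)
  open import Data.Nat.DivMod using (_mod_; m%n<n)
  open import Data.Nat.Properties using () renaming (_≟_ to _≟ℕ_)
  open import Data.Bool.Properties using () renaming (_≟_ to _≟ᵇ_)
  open import Data.Fin using (Fin; zero; suc; toℕ; _≟_)
  open import Data.Fin.Properties using (all?)
  open import Data.Product using (∃-syntax; _×_; _,_; proj₁; proj₂)
  open import Relation.Nullary using (¬_; does; yes; no)
  open import Relation.Nullary.Decidable using (from-yes; _→-dec_; ¬?; _×-dec_; dec-true)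
  open import Relation.Binary.PropositionalEquality

  infixl 6 _⊖_

  _⊖_ : Fin 35 → Fin 35 → Fin 35
  i ⊖ j = (toℕ i + (35 ∸ toℕ j)) mod 35

  ⊖_ : Fin 35 → Fin 35
  ⊖ i = (35 ∸ toℕ i) mod 35

  class : Fin 35 → ℕ
  class i = toℕ i % 7

  -- The symmetric connection set containing 7ℤ ∖ {0} and exactly u₁, u₂, u₃ from the classes 1, 2, 3
  -- (hence exactly their negatives from the classes 6, 5, 4).
  candidate : (u₁ u₂ u₃ : Fin 35) → Fin 35 → Bool
  candidate u₁ u₂ u₃ i with class i
  ... | 0 = not (does (i ≟ zero))
  ... | 1 = does (i ≟ u₁)
  ... | 2 = does (i ≟ u₂)
  ... | 3 = does (i ≟ u₃)
  ... | 4 = does (⊖ i ≟ u₃)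
  ... | 5 = does (⊖ i ≟ u₂)
  ... | _ = does (⊖ i ≟ u₁)

  λ-count : (Fin 35 → Bool) → Fin 35 → ℕ
  λ-count T s = # (λ j → T (s ⊖ j) ∧ T j)

  no-candidate : ∀ u₁ → class u₁ ≡ 1 → ∀ u₂ → class u₂ ≡ 2 → ∀ u₃ → class u₃ ≡ 3 →
    ¬ (λ-count (candidate u₁ u₂ u₃) u₁ ≡ 3 × λ-count (candidate u₁ u₂ u₃) u₂ ≡ 3)
  no-candidate = from-yes (
    all? λ u₁ → class u₁ ≟ℕ 1 →-dec all? λ u₂ → class u₂ ≟ℕ 2 →-dec all? λ u₃ → class u₃ ≟ℕ 3 →-dec
    ¬? (λ-count (candidate u₁ u₂ u₃) u₁ ≟ℕ 3 ×-dec λ-count (candidate u₁ u₂ u₃) u₂ ≟ℕ 3))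

  class-⊖ : ∀ i → class (⊖ i) ≡ (7 ∸ class i) % 7
  class-⊖ = from-yes (all? λ i → class (⊖ i) ≟ℕ (7 ∸ class i) % 7)

  sameClass : Fin 35 → Fin 35 → Bool
  sameClass i j = does (class i ≟ℕ class j)

  sameClass-⊖ : ∀ i j → does (class (j ⊖ i) ≟ℕ 0) ≡ sameClass i j
  sameClass-⊖ = from-yes (all? λ i → all? λ j → does (class (j ⊖ i) ≟ℕ 0) ≟ᵇ sameClass i j)

  module _ (T : Fin 35 → Bool)
    (T-zero : T zero ≡ false)
    (T-multiples-of-7 : ∀ i → class i ≡ 0 → i ≢ zero → T i ≡ true)
    (T-sym : ∀ i → T (⊖ i) ≡ T i)
    (T-class : ∀ i → class i ≢ 0 → # (T ∩ sameClass i) ≡ 1)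
    where

    class-representative : ∀ i → class i ≢ 0 →
      ∃[ u ] (class u ≡ class i × ∀ j → class j ≡ class i → T j ≡ (j == u))
    class-representative i ci≢0 with #≡1+n⇒∃ (T ∩ sameClass i) (T-class i ci≢0)
    ... | u , Tu∧ci≡cu = u , sym (does-true⇒ (class i ≟ℕ class u) (∩-elimʳ T (sameClass i) Tu∧ci≡cu)) , singleton
      where
      singleton : ∀ j → class j ≡ class i → T j ≡ (j == u)
      singleton j cj≡ci with j ≟ u
      ... | yes refl = ∩-elimˡ T (sameClass i) Tu∧ci≡cu
      ... | no j≢u with T j in Tj
      ...   | false = refl
      ...   | true  = ⊥-elim (1+n≰n (subst (2 ≤_) (T-class i ci≢0)
                        (2≤# (T ∩ sameClass i) (∩-intro T (sameClass i) Tj (dec-true (class i ≟ℕ class j) (sym cj≡ci)))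
                                               Tu∧ci≡cu j≢u)))

    module Representative (r : Fin 35) (cr≢0 : class r ≢ 0) where
      u : Fin 35
      u = proj₁ (class-representative r cr≢0)
      class-u : class u ≡ class r
      class-u = proj₁ (proj₂ (class-representative r cr≢0))
      members : ∀ j → class j ≡ class r → T j ≡ (j == u)
      members = proj₂ (proj₂ (class-representative r cr≢0))
      u∈T : T u ≡ true
      u∈T = trans (members u class-u) (==-refl u)

    private
      module R₁ = Representative (suc zero) (λ ())
      module R₂ = Representative (suc (suc zero)) (λ ())
      module R₃ = Representative (suc (suc (suc zero))) (λ ())

    T≗candidate : ∀ i → T i ≡ candidate R₁.u R₂.u R₃.u i
    T≗candidate i with class i in ci
    ... | 0 with i ≟ zero
    ...   | yes refl = T-zero
    ...   | no i≢0   = T-multiples-of-7 i ci i≢0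
    T≗candidate i | 1 = R₁.members i ci
    T≗candidate i | 2 = R₂.members i ci
    T≗candidate i | 3 = R₃.members i ci
    T≗candidate i | 4 = trans (sym (T-sym i)) (R₃.members (⊖ i) (trans (class-⊖ i) (cong (λ c → (7 ∸ c) % 7) ci)))
    T≗candidate i | 5 = trans (sym (T-sym i)) (R₂.members (⊖ i) (trans (class-⊖ i) (cong (λ c → (7 ∸ c) % 7) ci)))
    T≗candidate i | 6 = trans (sym (T-sym i)) (R₁.members (⊖ i) (trans (class-⊖ i) (cong (λ c → (7 ∸ c) % 7) ci)))
    T≗candidate i | suc (suc (suc (suc (suc (suc (suc _)))))) = ⊥-elim (7+c≮7 (subst (_< 7) ci (m%n<n (toℕ i) 7)))
      where 7+c≮7 : ∀ {c} → 7 + c < 7 → ⊥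
            7+c≮7 (s≤s (s≤s (s≤s (s≤s (s≤s (s≤s (s≤s ())))))))

    not-λ-regular : ¬ (∀ s → T s ≡ true → λ-count T s ≡ 3)
    not-λ-regular λ-regular =
      no-candidate R₁.u R₁.class-u R₂.u R₂.class-u R₃.u R₃.class-u (λ-candidate R₁.u R₁.u∈T , λ-candidate R₂.u R₂.u∈T)
      where
      λ-candidate : ∀ s → T s ≡ true → λ-count (candidate R₁.u R₂.u R₃.u) s ≡ 3
      λ-candidate s Ts = trans (#-cong λ j → sym (cong₂ _∧_ (T≗candidate (s ⊖ j)) (T≗candidate j))) (λ-regular s Ts)

module Coordinates {_·_ : Op₂ (Fin 35)} {ε : Fin 35} {_⁻¹′ : Op₁ (Fin 35)} (isGroup : IsGroup _≡_ _·_ ε _⁻¹′)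
  {g : Fin 35} (g-order : FiniteGroup.HasOrder isGroup g 35)
  where
  open FiniteGroup isGroup
  open Counting
  open Z35 using (_⊖_; ⊖_)
  open import Data.Nat using (_∸_)
  open import Data.Nat.Properties using (<⇒≤)
  open import Data.Nat.DivMod using (_mod_; m%n<n)
  open import Data.Fin using (toℕ)
  open import Data.Fin.Properties using (toℕ<n; toℕ-injective; toℕ-fromℕ<)
  open import Data.Product using (proj₁; proj₂)
  open import Relation.Binary.PropositionalEquality
  open HasOrder g-order renaming (^-order to g^35≡e)

  φ : Fin 35 → Fin 35
  φ i = g ^ toℕ i

  φ-injective : ∀ i j → φ i ≡ φ j → i ≡ j
  φ-injective i j eq = toℕ-injective (^-injective g-order (toℕ<n i) (toℕ<n j) eq)

  φ⁻¹ : Fin 35 → Fin 35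
  φ⁻¹ y = proj₁ (Image-elim φ (#≡n⇒true (Image φ) (#-image φ φ-injective) y))

  φ∘φ⁻¹ : ∀ y → φ (φ⁻¹ y) ≡ y
  φ∘φ⁻¹ y = proj₂ (Image-elim φ (#≡n⇒true (Image φ) (#-image φ φ-injective) y))

  φ⁻¹∘φ : ∀ i → φ⁻¹ (φ i) ≡ i
  φ⁻¹∘φ i = φ-injective _ _ (φ∘φ⁻¹ (φ i))

  #-∘φ : (P : Fin 35 → Bool) → # (λ i → P (φ i)) ≡ # P
  #-∘φ P = #-∘-inverse P φ φ⁻¹ φ⁻¹∘φ φ∘φ⁻¹

  φ-mod : ∀ k → φ (k mod 35) ≡ g ^ k
  φ-mod k = trans (cong (g ^_) (toℕ-fromℕ< (m%n<n k 35))) (sym (^-mod g 35 g^35≡e k))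

  φ-⊖ : ∀ i j → φ (i ⊖ j) ≡ φ i ∙ φ j ⁻¹
  φ-⊖ i j = trans (φ-mod (toℕ i + (35 ∸ toℕ j)))
    (trans (^-+ g (toℕ i) (35 ∸ toℕ j)) (cong (φ i ∙_) (^-inverse g g^35≡e (<⇒≤ (toℕ<n j)))))

  φ-⊖′ : ∀ i → φ (⊖ i) ≡ φ i ⁻¹
  φ-⊖′ i = trans (φ-mod (35 ∸ toℕ i)) (^-inverse g g^35≡e (<⇒≤ (toℕ<n i)))

  φ⁻¹∙φ : ∀ i j → φ i ⁻¹ ∙ φ j ≡ φ (j ⊖ i)
  φ⁻¹∙φ i j = begin
    φ i ⁻¹ ∙ φ j                 ≡⟨ cong (_∙ φ j) (φ-⊖′ i) ⟨
    g ^ toℕ (⊖ i) ∙ g ^ toℕ j    ≡⟨ ^-comm² refl (toℕ (⊖ i)) (toℕ j) ⟩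
    g ^ toℕ j ∙ g ^ toℕ (⊖ i)    ≡⟨ cong (φ j ∙_) (φ-⊖′ i) ⟩
    φ j ∙ φ i ⁻¹                 ≡⟨ φ-⊖ j i ⟨
    φ (j ⊖ i)                    ∎
    where open ≡-Reasoning


module NeumaierConnectionSet {_·_ : Op₂ (Fin 35)} {ε : Fin 35} {_⁻¹′ : Op₁ (Fin 35)}
  (isGroup : IsGroup _≡_ _·_ ε _⁻¹′)
  (S : Subset 35) (ε∉S : ε ∉ S) (S-sym : ∀ s → s ∈ S → (s ⁻¹′) ∈ S)
  (edgeRegular : IsEdgeRegular (Cay _·_ _⁻¹′ S) 10 3)
  {C : Fin 35 → Bool} (C-regular : IsRegularClique (Cay _·_ _⁻¹′ S) C 1) (#C : # C ≡ 5)
  where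
  open import Data.Bool using (_∧_)
  open import Data.Nat using (_<?_; _≤?_)
  open import Data.Nat.Properties using (*-comm) renaming (_≟_ to _≟ℕ_)
  open import Data.Nat.Divisibility using (_∣_; divides; n∣m⇒m%n≡0; m%n≡0⇒n∣m)
  open import Data.Fin using (zero; toℕ)
  open import Data.Product using (∃-syntax; Σ-syntax; proj₁; proj₂)
  open import Relation.Nullary using (does)
  open import Relation.Nullary.Decidable using (from-yes; dec-true; dec-false)
  open import Relation.Binary.PropositionalEquality
  open ≡-Reasoning
  open Counting
  open Z35
  open FiniteGroup isGroup
  open CayleyGraph isGroup S ε∉S S-sym
  open CliqueSubgroup edgeRegular (from-yes (4 + 4 <? 10)) (from-yes (10 ≤? 4 + 4 + 3)) C-regular #C
  open GroupOfOrder35 isGroup using (subgroup-of-order-5; module Generator)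

  private
    cyclic : ∃[ h ] Σ[ h-order ∈ HasOrder h 5 ] ∀ x → H x ≡ powers h-order x
    cyclic = subgroup-of-order-5 H-subgroup #H

    h : Fin 35
    h = proj₁ cyclic

    h-order : HasOrder h 5
    h-order = proj₁ (proj₂ cyclic)

    H≗⟨h⟩ : ∀ x → H x ≡ powers h-order x
    H≗⟨h⟩ = proj₂ (proj₂ cyclic)

  open Generator h-order using (g; g-order; H∋g^⇒7∣; H∋g^7k)
  open Coordinates isGroup g-order

  T : Fin 35 → Bool
  T i = inS (φ i)

  H-φ : ∀ i → H (φ i) ≡ does (class i ≟ℕ 0)
  H-φ i = ≡true-ext
    (λ H∋φi → dec-true (class i ≟ℕ 0) (n∣m⇒m%n≡0 (toℕ i) 7 (H∋g^⇒7∣ (toℕ i) (trans (sym (H≗⟨h⟩ (φ i))) H∋φi))))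
    (λ ci≡0 → trans (H≗⟨h⟩ (φ i)) (H∋φ (m%n≡0⇒n∣m (toℕ i) 7 (does-true⇒ (class i ≟ℕ 0) ci≡0))))
    where
    H∋φ : 7 ∣ toℕ i → powers h-order (φ i) ≡ true
    H∋φ (divides q i≡q*7) = subst (λ k → powers h-order (g ^ k) ≡ true) (sym (trans i≡q*7 (*-comm q 7))) (H∋g^7k q)

  T-zero : T zero ≡ false
  T-zero = inS-e

  T-multiples-of-7 : ∀ i → class i ≡ 0 → i ≢ zero → T i ≡ true
  T-multiples-of-7 i ci≡0 i≢0 = trans (sym (Γ-e (φ i)))
    (proj₁ H-regular (φ i) e (trans (H-φ i) (dec-true (class i ≟ℕ 0) ci≡0)) (IsSubgroup.e∈ H-subgroup)
       λ φi≡e → i≢0 (φ-injective i zero φi≡e))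

  T-sym : ∀ i → T (⊖ i) ≡ T i
  T-sym i = trans (cong inS (φ-⊖′ i)) (inS-⁻¹ (φ i))

  sameClass≡H : ∀ i j → sameClass i j ≡ H (φ i ⁻¹ ∙ φ j)
  sameClass≡H i j = trans (sym (sameClass-⊖ i j)) (trans (sym (H-φ (j ⊖ i))) (cong H (sym (φ⁻¹∙φ i j))))

  T-class : ∀ i → class i ≢ 0 → # (T ∩ sameClass i) ≡ 1
  T-class i ci≢0 = begin
    # (T ∩ sameClass i)                        ≡⟨ #-cong (λ j → cong (T j ∧_) (sameClass≡H i j)) ⟩
    # (λ j → inS (φ j) ∧ H (φ i ⁻¹ ∙ φ j))     ≡⟨ #-∘φ (λ s → inS s ∧ H (φ i ⁻¹ ∙ s)) ⟩
    # (λ s → inS s ∧ H (φ i ⁻¹ ∙ s))           ≡⟨ coset-meets-S-once (φ i) (trans (H-φ i) (dec-false (class i ≟ℕ 0) ci≢0)) ⟩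
    1                                          ∎

  λ-regular : ∀ s → T s ≡ true → λ-count T s ≡ 3
  λ-regular s Ts = begin
    λ-count T s                                ≡⟨ #-cong (λ j → cong₂ _∧_ (cong inS (φ-⊖ s j)) (sym (Γ-e (φ j)))) ⟩
    # (λ j → Γ (φ s) (φ j) ∧ Γ (φ j) e)        ≡⟨ #-∘φ (λ z → Γ (φ s) z ∧ Γ z e) ⟩
    # (λ z → Γ (φ s) z ∧ Γ z e)                ≡⟨ proj₂ edgeRegular (φ s) e (trans (Γ-e (φ s)) Ts) ⟩
    3                                          ∎

lemma4p9 : (_∙_ : Op₂ (Fin 35)) (e : Fin 35) (_⁻¹ : Op₁ (Fin 35)) →
    IsGroup _≡_ _∙_ e _⁻¹ →
    (S : Subset 35) → e ∉ S → (∀ s → s ∈ S → (s ⁻¹) ∈ S) →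
    ¬ IsNeumaier (Cay _∙_ _⁻¹ S) 10 3 1 5
lemma4p9 _ _ _ isGroup S e∉S S-sym (_ , edgeRegular , _ , #C , C-regular) =
  not-λ-regular T T-zero T-multiples-of-7 T-sym T-class λ-regular
  where
  open Z35 using (not-λ-regular)
  open NeumaierConnectionSet isGroup S e∉S S-sym edgeRegular C-regular #C
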